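{- Let $M\rightarrow M'$ be a matroid perspective on a finite linearly ordered set $E$. For non-negative integers $i,j,k,p,q$ let $a_{ijkpq}$ be the number of $A\subseteq E$ with $\iota_{M'}(A)=i$, $\epsilon_M(A)=j$, $rcd_{M,M'}(A)=k$, $r(M')-r_{M'}(A)=p$ and $|A|-r_M(A)=q$, and let $b_{ijk}$ be the number of $B\subseteq E$ spanning in $M'$ and independent in $M$ with $\iota_{M'}(B)=i$, $\epsilon_M(B)=j$ and $rcd_{M,M'}(B)=k$. Then for $p\le i$ and $q\le j$, $$a_{i-p,\,j-q,\,k,\,p,\,q}=\binom{i}{p}\binom{j}{q}b_{ijk}.$$
   Context: A matroid perspective $M\rightarrow M'$ is a pair of matroids $M,M'$ on the same finite set $E$ such that every circuit of $M$ is a union of circuits of $M'$ (equivalently, no circuit of $M$ and cocircuit of $M'$ intersect in exactly one element). For a matroid $N$ with rank function $r_N$, $r(N)=r_N(E)$; $\epsilon_N(A)$ is the number of $e\in E\setminus A$ that are the smallest element of some circuit of $N$ contained in $A\cup\{e\}$; $\iota_N(A)$ is the number of $e\in A$ that are the smallest element of some cocircuit of $N$ contained in $(E\setminus A)\cup\{e\}$. $rcd_{M,M'}(A)=r(M)-r(M')-(r_M(A)-r_{M'}(A))$. -}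

module Defs where

open import Data.Bool using (Bool; true; false; _∧_; _∨_; not; T)
open import Data.Nat using (ℕ; zero; suc; _+_; _∸_; _≤_; _<ᵇ_; _≤ᵇ_; _≡ᵇ_)
open import Data.Fin using (Fin; toℕ)
open import Data.Fin.Subset using (Subset; inside; outside; _∈_; _⊆_; _∪_; _∩_; ∁; ⁅_⁆; ∣_∣; ⊤)
open import Data.Vec using (Vec; []; _∷_; lookup)
open import Data.List using (List; []; _∷_; _++_; map; allFin)
import Data.Bool.ListAction as L
open import Data.Integer using (ℤ; +_) renaming (_-_ to _-ℤ_)
import Data.Integer as ℤ
open import Data.Product using (∃; _×_)
open import Relation.Nullary.Decidable using (⌊_⌋)

-- Matroids on E = Fin n (linearly ordered by the order of Fin n),
-- given by their rank function (rank axioms R1–R3).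

record Matroid (n : ℕ) : Set where
  field
    rank      : Subset n → ℕ
    rank-≤    : ∀ A → rank A ≤ ∣ A ∣
    rank-mono : ∀ {A B} → A ⊆ B → rank A ≤ rank B
    rank-sub  : ∀ A B → rank (A ∪ B) + rank (A ∩ B) ≤ rank A + rank B
open Matroid public

r : ∀ {n} → Matroid n → ℕ
r N = rank N ⊤

subsets : (n : ℕ) → List (Subset n)
subsets zero    = [] ∷ []
subsets (suc n) = map (inside ∷_) (subsets n) ++ map (outside ∷_) (subsets n)

countB : ∀ {a} {X : Set a} → (X → Bool) → List X → ℕ
countB p []       = 0
countB p (x ∷ xs) = if′ (p x)
  where
  if′ : Bool → ℕ
  if′ true  = suc (countB p xs)
  if′ false = countB p xs

_∈ᵇ_ : ∀ {n} → Fin n → Subset n → Bool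
e ∈ᵇ A = lookup A e

_⊆ᵇ_ : ∀ {n} → Subset n → Subset n → Bool
_⊆ᵇ_ {n} A B = L.all (λ f → not (f ∈ᵇ A) ∨ (f ∈ᵇ B)) (allFin n)

_⊂ᵇ_ : ∀ {n} → Subset n → Subset n → Bool
A ⊂ᵇ B = (A ⊆ᵇ B) ∧ (∣ A ∣ <ᵇ ∣ B ∣)

isMinOf : ∀ {n} → Fin n → Subset n → Bool
isMinOf {n} e C = (e ∈ᵇ C) ∧ L.all (λ f → not (f ∈ᵇ C) ∨ (toℕ e ≤ᵇ toℕ f)) (allFin n)

dependentR : ∀ {n} → (Subset n → ℕ) → Subset n → Bool
dependentR ρ A = ρ A <ᵇ ∣ A ∣

circuitR : ∀ {n} → (Subset n → ℕ) → Subset n → Bool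
circuitR {n} ρ C =
  dependentR ρ C ∧ L.all (λ D → not (D ⊂ᵇ C) ∨ not (dependentR ρ D)) (subsets n)

isCircuit : ∀ {n} → Matroid n → Subset n → Bool
isCircuit N = circuitR (rank N)

dualRank : ∀ {n} → Matroid n → Subset n → ℕ
dualRank N A = (∣ A ∣ + rank N (∁ A)) ∸ r N

isCocircuit : ∀ {n} → Matroid n → Subset n → Bool
isCocircuit N = circuitR (dualRank N)

-- Matroid perspective M → M': every circuit of M is a union of circuits
-- of M' (i.e. each of its elements lies in a circuit of M' contained in it).

Perspective : ∀ {n} → Matroid n → Matroid n → Set
Perspective M M' =
  ∀ C → T (isCircuit M C) → ∀ e → e ∈ C →
    ∃ λ C' → T (isCircuit M' C') × e ∈ C' × C' ⊆ C

ε : ∀ {n} → Matroid n → Subset n → ℕ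
ε {n} N A = countB
  (λ e → not (e ∈ᵇ A) ∧
         L.any (λ C → isCircuit N C ∧ (C ⊆ᵇ (A ∪ ⁅ e ⁆)) ∧ isMinOf e C) (subsets n))
  (allFin n)

ι : ∀ {n} → Matroid n → Subset n → ℕ
ι {n} N A = countB
  (λ e → (e ∈ᵇ A) ∧
         L.any (λ D → isCocircuit N D ∧ (D ⊆ᵇ (∁ A ∪ ⁅ e ⁆)) ∧ isMinOf e D) (subsets n))
  (allFin n)

rcd : ∀ {n} → Matroid n → Matroid n → Subset n → ℤ
rcd M M' A = ((+ r M) -ℤ (+ r M')) -ℤ ((+ rank M A) -ℤ (+ rank M' A))

infix 4 _≡ℤᵇ_
_≡ℤᵇ_ : ℤ → ℤ → Bool
x ≡ℤᵇ y = ⌊ x ℤ.≟ y ⌋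

a : ∀ {n} → Matroid n → Matroid n → ℕ → ℕ → ℕ → ℕ → ℕ → ℕ
a {n} M M' i j k p q = countB
  (λ A → (ι M' A ≡ᵇ i) ∧ (ε M A ≡ᵇ j) ∧ (rcd M M' A ≡ℤᵇ (+ k))
       ∧ ((r M' ∸ rank M' A) ≡ᵇ p) ∧ ((∣ A ∣ ∸ rank M A) ≡ᵇ q))
  (subsets n)

b : ∀ {n} → Matroid n → Matroid n → ℕ → ℕ → ℕ → ℕ
b {n} M M' i j k = countB
  (λ B → (rank M' B ≡ᵇ r M') ∧ (rank M B ≡ᵇ ∣ B ∣)
       ∧ (ι M' B ≡ᵇ i) ∧ (ε M B ≡ᵇ j) ∧ (rcd M M' B ≡ℤᵇ (+ k)))
  (subsets n)

module Submission where

-- For a perspective M → M' every A ⊆ E has a canonical basis B, spanning in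
-- M' and independent in M, such that A is obtained from B by deleting some elements
-- internally active in M' and adding some elements externally active in M (activity
-- being taken with respect to B and the order of E); conversely every such A has
-- canonical basis B.  Along the way the statistics change predictably: ι and ε
-- drop by the numbers p = |B ∖ A| and q = |A ∖ B| of deleted and added elements,
-- p and q are the corank of A in M' and the nullity of A in M, and rcd is
-- unchanged.  So the fibre over B of the sets counted by a_{i-p,j-q,k,p,q} has
-- C(i,p)·C(j,q) elements when B is counted by b_{ijk} and is empty otherwise, and
-- the identity follows by double counting.

open import Data.Bool using (Bool; true; false; _∧_; _∨_; not; T)
open import Data.Bool.Properties using (∧-zeroʳ; ∧-identityʳ; ∨-zeroʳ; ∨-identityʳ; T-∧; T-∨; T-≡)
import Data.Bool.ListAction as L
open import Data.Empty using (⊥; ⊥-elim)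
open import Data.Fin using (Fin; zero; suc; toℕ; fromℕ<)
import Data.Fin as F
open import Data.Fin.Properties using (toℕ-injective; toℕ<n; toℕ-fromℕ<)
open import Data.Fin.Subset using (Subset; inside; outside; _∪_; _∩_; ∁; ⁅_⁆; ∣_∣; ⊤; _∈_; _⊆_)
open import Data.Fin.Subset.Properties using (∣⁅x⁆∣≡1; p⊆q⇒∣p∣≤∣q∣)
open import Data.Integer using (ℤ; _⊖_) renaming (_-_ to _-ℤ_)
import Data.Integer as ℤ
import Data.Integer.Properties as ℤP
open import Data.List using (List; []; _∷_; _++_; map; allFin)
open import Data.List.Membership.Propositional using () renaming (_∈_ to _∈L_)
open import Data.List.Membership.Propositional.Properties using (∈-allFin; ∈-map⁺; ∈-++⁺ˡ; ∈-++⁺ʳ)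
open import Data.List.Relation.Unary.Any using (here; there)
open import Data.Nat using (ℕ; zero; suc; _+_; _*_; _∸_; _≤_; _<_; z≤n; s≤s; _<ᵇ_; _≤ᵇ_; _≡ᵇ_)
import Data.Nat as Nat
open import Data.Nat.Combinatorics using (_C_; nCk+nC[k+1]≡[n+1]C[k+1])
open import Data.Nat.Properties
open import Data.Nat.Solver using (module +-*-Solver)
open import Data.Product using (_×_; _,_; proj₁; proj₂; ∃; uncurry)
open import Data.Sum using (_⊎_; inj₁; inj₂)
open import Data.Unit using (tt)
open import Data.Vec using ([]; _∷_; lookup; tabulate)
open import Data.Vec.Properties using (lookup∘tabulate; tabulate∘lookup; tabulate-cong; lookup-zipWith; lookup-map; lookup-replicate; []=⇒lookup; lookup⇒[]=)
open import Function.Bundles using (Equivalence)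
open import Relation.Binary.Definitions using (tri<; tri≈; tri>)
open import Relation.Binary.PropositionalEquality
open import Relation.Nullary using (¬_; yes; no)
open import Relation.Nullary.Decidable using (toWitness; fromWitness)

open import Defs

bext : ∀ {x y : Bool} → (T x → T y) → (T y → T x) → x ≡ y
bext {false} {false} f g = refl
bext {false} {true} f g = ⊥-elim (g tt)
bext {true} {false} f g = ⊥-elim (f tt)
bext {true} {true} f g = refl

T∧ : ∀ {x y} → T x → T y → T (x ∧ y)
T∧ p q = Equivalence.from T-∧ (p , q)

T∧₁ : ∀ {x y} → T (x ∧ y) → T x
T∧₁ p = proj₁ (Equivalence.to T-∧ p)

T∧₂ : ∀ {x y} → T (x ∧ y) → T y
T∧₂ {x} p = proj₂ (Equivalence.to (T-∧ {x}) p)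

T∨₁ : ∀ {x y} → T x → T (x ∨ y)
T∨₁ p = Equivalence.from T-∨ (inj₁ p)

T∨₂ : ∀ {x y} → T y → T (x ∨ y)
T∨₂ {x} p = Equivalence.from (T-∨ {x}) (inj₂ p)

T∨-elim : ∀ {x y} → T (x ∨ y) → T x ⊎ T y
T∨-elim {x} = Equivalence.to (T-∨ {x})

Tnot : ∀ {x} → (T x → ⊥) → T (not x)
Tnot {false} f = tt
Tnot {true} f = ⊥-elim (f tt)

Tnot⁻ : ∀ {x} → T (not x) → T x → ⊥
Tnot⁻ {false} _ ()
Tnot⁻ {true} ()

Tdec : ∀ x → T x ⊎ (T x → ⊥)
Tdec true = inj₁ tt
Tdec false = inj₂ (λ ())

T≡ : ∀ {x} → T x → x ≡ true
T≡ = Equivalence.to T-≡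

≡T : ∀ {x} → x ≡ true → T x
≡T = Equivalence.from T-≡

eqF : ∀ {n} → Fin n → Fin n → Bool
eqF zero zero = true
eqF zero (suc j) = false
eqF (suc i) zero = false
eqF (suc i) (suc j) = eqF i j

eqF-refl : ∀ {n} (i : Fin n) → T (eqF i i)
eqF-refl zero = tt
eqF-refl (suc i) = eqF-refl i

eqF-≡ : ∀ {n} (i j : Fin n) → T (eqF i j) → i ≡ j
eqF-≡ zero zero _ = refl
eqF-≡ (suc i) (suc j) p = cong suc (eqF-≡ i j p)

setOf : ∀ {n} → (Fin n → Bool) → Subset n
setOf = tabulate

lookup-setOf : ∀ {n} (f : Fin n → Bool) i → lookup (setOf f) i ≡ f i
lookup-setOf f i = lookup∘tabulate f i

subset-ext : ∀ {n} {A B : Subset n} → (∀ i → lookup A i ≡ lookup B i) → A ≡ B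
subset-ext {A = A} {B} h = begin
  A ≡⟨ sym (tabulate∘lookup A) ⟩
  tabulate (lookup A) ≡⟨ tabulate-cong h ⟩
  tabulate (lookup B) ≡⟨ tabulate∘lookup B ⟩
  B ∎
  where open ≡-Reasoning

lookup-∪ : ∀ {n} (A B : Subset n) i → lookup (A ∪ B) i ≡ lookup A i ∨ lookup B i
lookup-∪ A B i = lookup-zipWith _∨_ i A B

lookup-∩ : ∀ {n} (A B : Subset n) i → lookup (A ∩ B) i ≡ lookup A i ∧ lookup B i
lookup-∩ A B i = lookup-zipWith _∧_ i A B

lookup-∁ : ∀ {n} (A : Subset n) i → lookup (∁ A) i ≡ not (lookup A i)
lookup-∁ A i = lookup-map i not A

lookup-⊤ : ∀ {n} (i : Fin n) → lookup (⊤ {n}) i ≡ true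
lookup-⊤ i = lookup-replicate i true

lookup-⁅⁆ : ∀ {n} (e i : Fin n) → lookup ⁅ e ⁆ i ≡ eqF e i
lookup-⁅⁆ zero zero = refl
lookup-⁅⁆ zero (suc i) = lookup-replicate i false
lookup-⁅⁆ (suc e) zero = refl
lookup-⁅⁆ (suc e) (suc i) = lookup-⁅⁆ e i

∈→T : ∀ {n} {A : Subset n} {i} → i ∈ A → T (lookup A i)
∈→T p = ≡T ([]=⇒lookup p)

T→∈ : ∀ {n} {A : Subset n} {i} → T (lookup A i) → i ∈ A
T→∈ {A = A} {i} p = lookup⇒[]= i A (T≡ p)

-- Inclusion stated through Boolean lookups; this is the form in which
-- inclusions are produced by the pointwise set constructions below.
record _⊑_ {n} (A B : Subset n) : Set where
  constructor incl
  field at : ∀ i → T (lookup A i) → T (lookup B i)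
open _⊑_ public

⊑→⊆ : ∀ {n} {A B : Subset n} → A ⊑ B → A ⊆ B
⊑→⊆ h p = T→∈ (at h _ (∈→T p))

⊆→⊑ : ∀ {n} {A B : Subset n} → A ⊆ B → A ⊑ B
⊆→⊑ h = incl (λ i p → ∈→T (h (T→∈ p)))

⊑-refl : ∀ {n} {X : Subset n} → X ⊑ X
⊑-refl = incl (λ i p → p)

⊑-trans : ∀ {n} {X Y Z : Subset n} → X ⊑ Y → Y ⊑ Z → X ⊑ Z
⊑-trans a b = incl (λ i p → at b i (at a i p))

⊑-antisym : ∀ {n} {X Y : Subset n} → X ⊑ Y → Y ⊑ X → X ≡ Y
⊑-antisym a b = subset-ext (λ i → bext (at a i) (at b i))

setOf-intro : ∀ {n} (f : Fin n → Bool) {i} → T (f i) → T (lookup (setOf f) i)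
setOf-intro f {i} p = subst T (sym (lookup-setOf f i)) p

setOf-elim : ∀ {n} (f : Fin n → Bool) {i} → T (lookup (setOf f) i) → T (f i)
setOf-elim f {i} p = subst T (lookup-setOf f i) p

⊑-setOf : ∀ {n} {X : Subset n} (f : Fin n → Bool) → (∀ i → T (lookup X i) → T (f i)) → X ⊑ setOf f
⊑-setOf f h = incl (λ i p → setOf-intro f (h i p))

setOf-⊑ : ∀ {n} {X : Subset n} (f : Fin n → Bool) → (∀ i → T (f i) → T (lookup X i)) → setOf f ⊑ X
setOf-⊑ f h = incl (λ i p → h i (setOf-elim f p))

∅ : ∀ {n} → Subset n
∅ = setOf (λ _ → false)

∅⊑ : ∀ {n} {X : Subset n} → ∅ ⊑ X
∅⊑ {n} = incl (λ i p → ⊥-elim (setOf-elim {n} (λ _ → false) p))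

count : ∀ {n} → (Fin n → Bool) → ℕ
count {zero} f = 0
count {suc n} f with f zero
... | true = suc (count (λ i → f (suc i)))
... | false = count (λ i → f (suc i))

count-cong : ∀ {n} {f g : Fin n → Bool} → (∀ i → f i ≡ g i) → count f ≡ count g
count-cong {zero} h = refl
count-cong {suc n} {f} {g} h with f zero | g zero | h zero
... | true | true | refl = cong suc (count-cong (λ i → h (suc i)))
... | false | false | refl = count-cong (λ i → h (suc i))

count-∨ : ∀ {n} (f g : Fin n → Bool) → (∀ i → T (f i) → T (g i) → ⊥) → count (λ i → f i ∨ g i) ≡ count f + count g
count-∨ {zero} f g d = refl
count-∨ {suc n} f g d with f zero in ef | g zero in eg
... | true | true = ⊥-elim (d zero (≡T ef) (≡T eg))
... | true | false = cong suc (count-∨ (λ i → f (suc i)) (λ i → g (suc i)) (λ i → d (suc i)))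
... | false | true = trans (cong suc (count-∨ (λ i → f (suc i)) (λ i → g (suc i)) (λ i → d (suc i)))) (sym (+-suc _ _))
... | false | false = count-∨ (λ i → f (suc i)) (λ i → g (suc i)) (λ i → d (suc i))

count-none : ∀ {n} (f : Fin n → Bool) → (∀ i → T (f i) → ⊥) → count f ≡ 0
count-none {zero} f h = refl
count-none {suc n} f h with f zero in ef
... | true = ⊥-elim (h zero (≡T ef))
... | false = count-none (λ i → f (suc i)) (λ i → h (suc i))

count-eqF : ∀ {n} (e : Fin n) → count (eqF e) ≡ 1
count-eqF {suc n} zero = cong suc (count-none {n} (λ i → eqF zero (suc i)) (λ i ()))
count-eqF {suc n} (suc e) = count-eqF e

∣∣≡count : ∀ {n} (A : Subset n) → ∣ A ∣ ≡ count (lookup A)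
∣∣≡count [] = refl
∣∣≡count (true ∷ A) = cong suc (∣∣≡count A)
∣∣≡count (false ∷ A) = ∣∣≡count A

∣setOf∣ : ∀ {n} (f : Fin n → Bool) → ∣ setOf f ∣ ≡ count f
∣setOf∣ f = trans (∣∣≡count (setOf f)) (count-cong (lookup-setOf f))

countB-tabulate : ∀ {n} (p : Fin n → Bool) m (g : Fin m → Fin n) → countB p (Data.List.tabulate g) ≡ count (λ i → p (g i))
countB-tabulate p zero g = refl
countB-tabulate p (suc m) g with p (g zero)
... | true = cong suc (countB-tabulate p m (λ i → g (suc i)))
... | false = countB-tabulate p m (λ i → g (suc i))

countB-allFin : ∀ {n} (p : Fin n → Bool) → countB p (allFin n) ≡ count p
countB-allFin {n} p = countB-tabulate p n (λ x → x)

∣∣-split : ∀ {n} (X D R : Subset n) → (∀ i → lookup X i ≡ lookup D i ∨ lookup R i) →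
  (∀ i → T (lookup D i) → T (lookup R i) → ⊥) → ∣ X ∣ ≡ ∣ D ∣ + ∣ R ∣
∣∣-split X D R h d = begin
  ∣ X ∣ ≡⟨ ∣∣≡count X ⟩
  count (lookup X) ≡⟨ count-cong h ⟩
  count (λ i → lookup D i ∨ lookup R i) ≡⟨ count-∨ (lookup D) (lookup R) d ⟩
  count (lookup D) + count (lookup R) ≡⟨ sym (cong₂ _+_ (∣∣≡count D) (∣∣≡count R)) ⟩
  ∣ D ∣ + ∣ R ∣ ∎
  where open ≡-Reasoning

∪-intro : ∀ {n} {X Y Z : Subset n} → X ⊑ Z → Y ⊑ Z → (X ∪ Y) ⊑ Z
∪-intro {X = X} {Y} {Z} a b = incl go
  where
  go : ∀ i → T (lookup (X ∪ Y) i) → T (lookup Z i)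
  go i p with T∨-elim {lookup X i} (subst T (lookup-∪ X Y i) p)
  ... | inj₁ q = at a i q
  ... | inj₂ q = at b i q

∪-l : ∀ {n} (X Y : Subset n) → X ⊑ (X ∪ Y)
∪-l X Y = incl (λ i p → subst T (sym (lookup-∪ X Y i)) (T∨₁ p))

∪-r : ∀ {n} (X Y : Subset n) → Y ⊑ (X ∪ Y)
∪-r X Y = incl (λ i p → subst T (sym (lookup-∪ X Y i)) (T∨₂ {lookup X i} p))

∩-intro : ∀ {n} {X Y Z : Subset n} → Z ⊑ X → Z ⊑ Y → Z ⊑ (X ∩ Y)
∩-intro {X = X} {Y} a b = incl (λ i p → subst T (sym (lookup-∩ X Y i)) (T∧ (at a i p) (at b i p)))

_+e_ : ∀ {n} → Subset n → Fin n → Subset n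
X +e e = X ∪ ⁅ e ⁆

lookup-+e : ∀ {n} (X : Subset n) e i → lookup (X +e e) i ≡ lookup X i ∨ eqF e i
lookup-+e X e i = trans (lookup-∪ X ⁅ e ⁆ i) (cong (lookup X i ∨_) (lookup-⁅⁆ e i))

⊑+e : ∀ {n} (X : Subset n) e → X ⊑ (X +e e)
⊑+e X e = incl (λ i p → subst T (sym (lookup-+e X e i)) (T∨₁ p))

e∈+e : ∀ {n} (X : Subset n) e → T (lookup (X +e e) e)
e∈+e X e = subst T (sym (lookup-+e X e e)) (T∨₂ {lookup X e} (eqF-refl e))

in+e : ∀ {n} {X : Subset n} {e i} → T (lookup (X +e e) i) → T (lookup X i) ⊎ (e ≡ i)
in+e {X = X} {e} {i} p with T∨-elim {lookup X i} (subst T (lookup-+e X e i) p)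
... | inj₁ q = inj₁ q
... | inj₂ q = inj₂ (eqF-≡ e i q)

+e⊑ : ∀ {n} {X Y : Subset n} {e} → X ⊑ Y → T (lookup Y e) → (X +e e) ⊑ Y
+e⊑ {X = X} {Y} {e} h q = incl go
  where
  go : ∀ i → T (lookup (X +e e) i) → T (lookup Y i)
  go i p with in+e {X = X} {e} {i} p
  ... | inj₁ r = at h i r
  ... | inj₂ eq = subst (λ z → T (lookup Y z)) eq q

+e-mono : ∀ {n} {X Y : Subset n} {e} → X ⊑ Y → (X +e e) ⊑ (Y +e e)
+e-mono {Y = Y} {e} h = +e⊑ (⊑-trans h (⊑+e Y e)) (e∈+e Y e)

∣+e∣ : ∀ {n} (X : Subset n) e → (T (lookup X e) → ⊥) → ∣ X +e e ∣ ≡ suc ∣ X ∣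
∣+e∣ X e ne = trans (∣∣-split (X +e e) X ⁅ e ⁆ (λ i → trans (lookup-+e X e i) (cong (lookup X i ∨_) (sym (lookup-⁅⁆ e i))))
  (λ i p q → ne (subst (λ z → T (lookup X z)) (sym (eqF-≡ e i (subst T (lookup-⁅⁆ e i) q))) p)))
  (trans (cong (∣ X ∣ +_) (∣⁅x⁆∣≡1 e)) (+-comm ∣ X ∣ 1))

del : ∀ {n} → Subset n → Fin n → Subset n
del X e = setOf (λ f → lookup X f ∧ not (eqF e f))

del⊑ : ∀ {n} (X : Subset n) e → del X e ⊑ X
del⊑ X e = setOf-⊑ _ (λ i p → T∧₁ p)

del-mono : ∀ {n} {X Y : Subset n} e → X ⊑ Y → del X e ⊑ del Y e
del-mono {X = X} {Y} e h = incl (λ i p → setOf-intro (λ f → lookup Y f ∧ not (eqF e f)) (T∧ (at h i (T∧₁ (setOf-elim (λ f → lookup X f ∧ not (eqF e f)) p))) (T∧₂ {lookup X i} (setOf-elim (λ f → lookup X f ∧ not (eqF e f)) p))))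

del-notin : ∀ {n} (X : Subset n) e → T (lookup (del X e) e) → ⊥
del-notin X e p = Tnot⁻ (T∧₂ {lookup X e} (setOf-elim (λ f → lookup X f ∧ not (eqF e f)) p)) (eqF-refl e)

del-in : ∀ {n} (X : Subset n) e i → T (lookup X i) → (e ≡ i → ⊥) → T (lookup (del X e) i)
del-in X e i p ne = setOf-intro (λ f → lookup X f ∧ not (eqF e f)) (T∧ p (Tnot (λ q → ne (eqF-≡ e i q))))

del+e : ∀ {n} (X : Subset n) e → T (lookup X e) → (del X e +e e) ≡ X
del+e X e p = ⊑-antisym (+e⊑ (del⊑ X e) p) (incl go)
  where
  go : ∀ i → T (lookup X i) → T (lookup (del X e +e e) i)
  go i q with e F.≟ i
  ... | yes refl = e∈+e (del X e) e
  ... | no ne = at (⊑+e (del X e) e) i (del-in X e i q ne)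

∣del∣ : ∀ {n} (X : Subset n) e → T (lookup X e) → suc ∣ del X e ∣ ≡ ∣ X ∣
∣del∣ X e p = trans (sym (∣+e∣ (del X e) e (del-notin X e))) (cong ∣_∣ (del+e X e p))

del-notin' : ∀ {n} (X : Subset n) e i → T (lookup (del X e) i) → (e ≡ i → ⊥)
del-notin' X e i p refl = del-notin X e p

swap+e : ∀ {n} (W : Subset n) a b → ((W +e a) +e b) ≡ ((W +e b) +e a)
swap+e W a b = ⊑-antisym (+e⊑ (+e⊑ (⊑-trans (⊑+e W b) (⊑+e (W +e b) a)) (e∈+e (W +e b) a)) (at (⊑+e (W +e b) a) b (e∈+e W b)))
                         (+e⊑ (+e⊑ (⊑-trans (⊑+e W a) (⊑+e (W +e a) b)) (e∈+e (W +e a) b)) (at (⊑+e (W +e a) b) a (e∈+e W a)))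

module Closure {n} (N : Matroid n) where
  ρ : Subset n → ℕ
  ρ = rank N

  Cl : Fin n → Subset n → Set
  Cl e X = ρ (X +e e) ≡ ρ X

  Ind : Subset n → Set
  Ind X = ρ X ≡ ∣ X ∣

  mono : ∀ {A B} → A ⊑ B → ρ A ≤ ρ B
  mono h = rank-mono N (⊑→⊆ h)

  ρ≤ : ∀ A → ρ A ≤ ∣ A ∣
  ρ≤ = rank-≤ N

  ρcong : ∀ {A B} → A ≡ B → ρ A ≡ ρ B
  ρcong = cong ρ

  submod : ∀ X Y U V → U ⊑ (X ∪ Y) → V ⊑ (X ∩ Y) → (X ∪ Y) ⊑ U → ρ U + ρ V ≤ ρ X + ρ Y
  submod X Y U V a b c = ≤-trans (+-mono-≤ (≤-reflexive (ρcong (⊑-antisym a c))) (mono b)) (rank-sub N X Y)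

  subadd : ∀ X Y → ρ (X ∪ Y) ≤ ρ X + ρ Y
  subadd X Y = ≤-trans (m≤m+n _ _) (rank-sub N X Y)

  rank-+e≤ : ∀ X e → ρ (X +e e) ≤ suc (ρ X)
  rank-+e≤ X e = ≤-trans (subadd X ⁅ e ⁆) (≤-trans (+-monoʳ-≤ (ρ X) (≤-trans (ρ≤ ⁅ e ⁆) (≤-reflexive (∣⁅x⁆∣≡1 e))))
               (≤-reflexive (+-comm (ρ X) 1)))

  ρ+e : ∀ X e → ρ X ≤ ρ (X +e e)
  ρ+e X e = mono (⊑+e X e)

  ¬Cl⇒rank+1 : ∀ {X e} → ¬ Cl e X → ρ (X +e e) ≡ suc (ρ X)
  ¬Cl⇒rank+1 {X} {e} ne = ≤-antisym (rank-+e≤ X e) (≤∧≢⇒< (ρ+e X e) (λ q → ne (sym q)))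

  Cl? : ∀ e X → Cl e X ⊎ ¬ Cl e X
  Cl? e X with ρ (X +e e) Nat.≟ ρ X
  ... | yes p = inj₁ p
  ... | no p = inj₂ p

  Cl-≤ : ∀ {X e} → ρ (X +e e) ≤ ρ X → Cl e X
  Cl-≤ {X} {e} h = ≤-antisym h (ρ+e X e)

  Cl-mono : ∀ {X Y e} → X ⊑ Y → Cl e X → Cl e Y
  Cl-mono {X} {Y} {e} h c = Cl-≤ (+-cancelʳ-≤ (ρ X) _ _ (begin
      ρ (Y +e e) + ρ X ≤⟨ submod Y (X +e e) (Y +e e) X
                             (+e⊑ (∪-l Y (X +e e)) (at (∪-r Y (X +e e)) e (e∈+e X e)))
                             (∩-intro h (⊑+e X e))
                             (∪-intro (⊑+e Y e) (+e-mono h)) ⟩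
      ρ Y + ρ (X +e e) ≡⟨ cong (ρ Y +_) c ⟩
      ρ Y + ρ X ∎))
    where open ≤-Reasoning

  rank-≡-∪ : ∀ {X Y} Z → Y ⊑ X → ρ X ≡ ρ Y → ρ (X ∪ Z) ≡ ρ (Y ∪ Z)
  rank-≡-∪ {X} {Y} Z h eq = ≤-antisym (+-cancelʳ-≤ (ρ Y) _ _ (begin
      ρ (X ∪ Z) + ρ Y ≤⟨ submod X (Y ∪ Z) (X ∪ Z) Y
           (∪-intro (∪-l X (Y ∪ Z)) (⊑-trans (∪-r Y Z) (∪-r X (Y ∪ Z))))
           (∩-intro h (∪-l Y Z))
           (∪-intro (∪-l X Z) (∪-intro (⊑-trans h (∪-l X Z)) (∪-r X Z))) ⟩
      ρ X + ρ (Y ∪ Z) ≡⟨ cong (_+ ρ (Y ∪ Z)) eq ⟩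
      ρ Y + ρ (Y ∪ Z) ≡⟨ +-comm (ρ Y) _ ⟩
      ρ (Y ∪ Z) + ρ Y ∎))
    (mono (∪-intro (⊑-trans h (∪-l X Z)) (∪-r X Z)))
    where open ≤-Reasoning

  Cl-∈ : ∀ {X e} → T (lookup X e) → Cl e X
  Cl-∈ {X} {e} p = ρcong (⊑-antisym (+e⊑ ⊑-refl p) (⊑+e X e))

  exchange : ∀ {W e i} → Cl e (W +e i) → ¬ Cl i (W +e e) → Cl e W
  exchange {W} {e} {i} c nc with Cl? e W
  ... | inj₁ p = p
  ... | inj₂ np = ⊥-elim (nc (Cl-≤ (begin
      ρ ((W +e e) +e i) ≡⟨ ρcong (swap+e W e i) ⟩
      ρ ((W +e i) +e e) ≡⟨ c ⟩
      ρ (W +e i) ≤⟨ rank-+e≤ W i ⟩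
      suc (ρ W) ≡⟨ sym (¬Cl⇒rank+1 np) ⟩
      ρ (W +e e) ∎)))
    where open ≤-Reasoning

  Cl-trans : ∀ {W j e} → Cl j W → Cl e (W +e j) → Cl e W
  Cl-trans {W} {j} {e} cj ce = Cl-≤ (begin
      ρ (W +e e) ≤⟨ mono (+e-mono (⊑+e W j)) ⟩
      ρ ((W +e j) +e e) ≡⟨ ce ⟩
      ρ (W +e j) ≡⟨ cj ⟩
      ρ W ∎)
    where open ≤-Reasoning

  indep-⊑ : ∀ {D X} → D ⊑ X → Ind X → Ind D
  indep-⊑ {D} {X} h ix = ≤-antisym (ρ≤ D) (+-cancelʳ-≤ ∣ R ∣ _ _ (begin
      ∣ D ∣ + ∣ R ∣ ≡⟨ sym cs ⟩
      ∣ X ∣ ≡⟨ sym ix ⟩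
      ρ X ≤⟨ ≤-trans (m≤m+n _ _) (submod D R X ∅ ux1 ∅⊑ ux2) ⟩
      ρ D + ρ R ≤⟨ +-monoʳ-≤ (ρ D) (ρ≤ R) ⟩
      ρ D + ∣ R ∣ ∎))
    where
    open ≤-Reasoning
    fR : Fin n → Bool
    fR i = lookup X i ∧ not (lookup D i)
    R : Subset n
    R = setOf fR
    case1 : ∀ i → T (lookup X i) → T (lookup D i ∨ lookup R i)
    case1 i p with Tdec (lookup D i)
    ... | inj₁ d = T∨₁ d
    ... | inj₂ nd = T∨₂ {lookup D i} (setOf-intro fR (T∧ p (Tnot nd)))
    case2 : ∀ i → T (lookup D i ∨ lookup R i) → T (lookup X i)
    case2 i p with T∨-elim {lookup D i} p
    ... | inj₁ d = at h i d
    ... | inj₂ r = T∧₁ (setOf-elim fR r)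
    cs : ∣ X ∣ ≡ ∣ D ∣ + ∣ R ∣
    cs = ∣∣-split X D R (λ i → bext (case1 i) (case2 i))
           (λ i p q → Tnot⁻ (T∧₂ {lookup X i} (setOf-elim fR q)) p)
    ux1 : X ⊑ (D ∪ R)
    ux1 = incl (λ i p → subst T (sym (lookup-∪ D R i)) (case1 i p))
    ux2 : (D ∪ R) ⊑ X
    ux2 = incl (λ i p → case2 i (subst T (lookup-∪ D R i) p))

  Cl-transfer : ∀ {X Y e} → Y ⊑ X → ρ X ≡ ρ Y → Cl e X → Cl e Y
  Cl-transfer {X} {Y} {e} h eq c = Cl-≤ (begin
    ρ (Y +e e) ≤⟨ mono (+e-mono h) ⟩
    ρ (X +e e) ≡⟨ c ⟩
    ρ X ≡⟨ eq ⟩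
    ρ Y ∎)
    where open ≤-Reasoning

  indep-not-closed : ∀ {B X e} → Ind B → T (lookup B e) → X ⊑ del B e → ¬ Cl e X
  indep-not-closed {B} {X} {e} ib eB h c = <-irrefl (sym eq) (s≤s ≤-refl)
    where
    c' : Cl e (del B e)
    c' = Cl-mono h c
    eq : suc ∣ del B e ∣ ≡ ∣ del B e ∣
    eq = begin
      suc ∣ del B e ∣ ≡⟨ ∣del∣ B e eB ⟩
      ∣ B ∣ ≡⟨ sym ib ⟩
      ρ B ≡⟨ cong ρ (sym (del+e B e eB)) ⟩
      ρ (del B e +e e) ≡⟨ c' ⟩
      ρ (del B e) ≡⟨ indep-⊑ (del⊑ B e) ib ⟩
      ∣ del B e ∣ ∎
      where open ≡-Reasoning

downward-induction : ∀ {n} (P : ℕ → Set) → (∀ t → n ≤ t → P t) → (∀ (i : Fin n) → P (suc (toℕ i)) → P (toℕ i)) → ∀ t → P t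
downward-induction {n} P base step t = go n t (m≤m+n n t)
  where
  go : ∀ d t → n ≤ d + t → P t
  go zero t h = base t h
  go (suc d) t h with n Nat.≤? t
  ... | yes q = base t q
  ... | no q = subst P (toℕ-fromℕ< t<n) (step (fromℕ< t<n) (subst (λ z → P (suc z)) (sym (toℕ-fromℕ< t<n)) (go d (suc t) (subst (n ≤_) (sym (+-suc d t)) h))))
    where
    t<n : t < n
    t<n = ≰⇒> q

upward-induction : ∀ {n} (P : ℕ → Set) → P 0 → (∀ (i : Fin n) → P (toℕ i) → P (suc (toℕ i))) → ∀ t → t ≤ n → P t
upward-induction P p0 step zero h = p0
upward-induction {n} P p0 step (suc t) h = subst P (cong suc (toℕ-fromℕ< h)) (step (fromℕ< h) (subst P (sym (toℕ-fromℕ< h)) (upward-induction P p0 step t (<⇒≤ h))))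

eqF-true : ∀ {n} (i : Fin n) → eqF i i ≡ true
eqF-true i = T≡ (eqF-refl i)

eqF-false : ∀ {n} {i f : Fin n} → i ≢ f → eqF i f ≡ false
eqF-false {i = i} {f} ne with eqF i f in e
... | true = ⊥-elim (ne (eqF-≡ i f (≡T e)))
... | false = refl

≤ᵇ-true : ∀ {a b} → a ≤ b → (a ≤ᵇ b) ≡ true
≤ᵇ-true h = T≡ (≤⇒≤ᵇ h)

≤ᵇ-false : ∀ {a b} → b < a → (a ≤ᵇ b) ≡ false
≤ᵇ-false {a} {b} h with a ≤ᵇ b in e
... | true = ⊥-elim (<⇒≱ h (≤ᵇ⇒≤ a b (≡T e)))
... | false = refl

<ᵇ-true : ∀ {a b} → a < b → (a <ᵇ b) ≡ true
<ᵇ-true h = T≡ (<⇒<ᵇ h)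

<ᵇ-false : ∀ {a b} → b ≤ a → (a <ᵇ b) ≡ false
<ᵇ-false {a} {b} h with a <ᵇ b in e
... | true = ⊥-elim (<⇒≱ (<ᵇ⇒< a b (≡T e)) h)
... | false = refl

ge-neq : ∀ {n} {i f : Fin n} → i ≢ f → (toℕ i ≤ᵇ toℕ f) ≡ (suc (toℕ i) ≤ᵇ toℕ f)
ge-neq {i = i} {f} ne with <-cmp (toℕ i) (toℕ f)
... | tri< a _ _ = trans (≤ᵇ-true (<⇒≤ a)) (sym (≤ᵇ-true a))
... | tri≈ _ b _ = ⊥-elim (ne (toℕ-injective b))
... | tri> _ _ c = trans (≤ᵇ-false c) (sym (≤ᵇ-false (m<n⇒m<1+n c)))

lt-neq : ∀ {n} {i f : Fin n} → i ≢ f → (toℕ f <ᵇ suc (toℕ i)) ≡ (toℕ f <ᵇ toℕ i)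
lt-neq {i = i} {f} ne with <-cmp (toℕ i) (toℕ f)
... | tri< a _ _ = trans (<ᵇ-false a) (sym (<ᵇ-false (<⇒≤ a)))
... | tri≈ _ b _ = ⊥-elim (ne (toℕ-injective b))
... | tri> _ _ c = trans (<ᵇ-true (m<n⇒m<1+n c)) (sym (<ᵇ-true c))

gs-self : ∀ {n} (i : Fin n) → (suc (toℕ i) ≤ᵇ toℕ i) ≡ false
gs-self i = ≤ᵇ-false {suc (toℕ i)} {toℕ i} ≤-refl

lt-self : ∀ {n} (i : Fin n) → (toℕ i <ᵇ toℕ i) ≡ false
lt-self i = <ᵇ-false {toℕ i} {toℕ i} ≤-refl

ls-self : ∀ {n} (i : Fin n) → (toℕ i <ᵇ suc (toℕ i)) ≡ true
ls-self i = <ᵇ-true {toℕ i} {suc (toℕ i)} ≤-refl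

member? : ∀ {n} (X : Subset n) f → T (lookup X f) ⊎ (T (lookup X f) → ⊥)
member? X f = Tdec (lookup X f)

trichotomy : ∀ {n} (e f : Fin n) → (e ≡ f) ⊎ (toℕ e < toℕ f) ⊎ (toℕ f < toℕ e)
trichotomy e f with <-cmp (toℕ e) (toℕ f)
... | tri< a _ _ = inj₂ (inj₁ a)
... | tri≈ _ b _ = inj₁ (toℕ-injective b)
... | tri> _ _ c = inj₂ (inj₂ c)

toℕ<⇒≢ : ∀ {n} {e f : Fin n} → toℕ e < toℕ f → e ≡ f → ⊥
toℕ<⇒≢ lt refl = <-irrefl refl lt

dropFrom : ∀ {n} → Subset n → Subset n → ℕ → Subset n
dropFrom W0 R t = setOf (λ f → lookup W0 f ∧ not (lookup R f ∧ (t ≤ᵇ toℕ f)))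

dropFrom-step : ∀ {n} (W0 R : Subset n) (i : Fin n) → R ⊑ W0 → T (lookup R i) →
  dropFrom W0 R (suc (toℕ i)) ≡ (dropFrom W0 R (toℕ i) +e i)
dropFrom-step W0 R i h ri = subset-ext pt
  where
  pt : ∀ f → lookup (dropFrom W0 R (suc (toℕ i))) f ≡ lookup (dropFrom W0 R (toℕ i) +e i) f
  pt f rewrite lookup-setOf (λ f → lookup W0 f ∧ not (lookup R f ∧ (suc (toℕ i) ≤ᵇ toℕ f))) f
             | lookup-+e (dropFrom W0 R (toℕ i)) i f
             | lookup-setOf (λ f → lookup W0 f ∧ not (lookup R f ∧ (toℕ i ≤ᵇ toℕ f))) f
             with i F.≟ f
  ... | yes refl = trans l1 (sym r1)
    where
    l1 : (lookup W0 i ∧ not (lookup R i ∧ (suc (toℕ i) ≤ᵇ toℕ i))) ≡ true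
    l1 rewrite gs-self i | ∧-zeroʳ (lookup R i) | T≡ (at h i ri) = refl
    r1 : ((lookup W0 i ∧ not (lookup R i ∧ (toℕ i ≤ᵇ toℕ i))) ∨ eqF i i) ≡ true
    r1 rewrite eqF-true i = ∨-zeroʳ _
  ... | no ne rewrite eqF-false ne | ge-neq ne = sym (∨-identityʳ _)

dropFrom-skip : ∀ {n} (W0 R : Subset n) (i : Fin n) → (T (lookup R i) → ⊥) →
  dropFrom W0 R (suc (toℕ i)) ≡ dropFrom W0 R (toℕ i)
dropFrom-skip W0 R i nr = subset-ext pt
  where
  pt : ∀ f → lookup (dropFrom W0 R (suc (toℕ i))) f ≡ lookup (dropFrom W0 R (toℕ i)) f
  pt f rewrite lookup-setOf (λ f → lookup W0 f ∧ not (lookup R f ∧ (suc (toℕ i) ≤ᵇ toℕ f))) f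
             | lookup-setOf (λ f → lookup W0 f ∧ not (lookup R f ∧ (toℕ i ≤ᵇ toℕ f))) f
             with i F.≟ f
  ... | yes refl with lookup R i in e
  ... | true = ⊥-elim (nr tt)
  ... | false = refl
  pt f | no ne rewrite ge-neq ne = refl

dropFrom-top : ∀ {n} (W0 R : Subset n) t → n ≤ t → dropFrom W0 R t ≡ W0
dropFrom-top W0 R t h = subset-ext pt
  where
  pt : ∀ f → lookup (dropFrom W0 R t) f ≡ lookup W0 f
  pt f rewrite lookup-setOf (λ f → lookup W0 f ∧ not (lookup R f ∧ (t ≤ᵇ toℕ f))) f
             | ≤ᵇ-false (<-≤-trans (toℕ<n f) h) | ∧-zeroʳ (lookup R f) = ∧-identityʳ _

dropFrom-elim : ∀ {n} (W0 R : Subset n) t f → T (lookup (dropFrom W0 R t) f) → T (lookup W0 f) × (T (lookup R f) → t ≤ toℕ f → ⊥)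
dropFrom-elim W0 R t f p = T∧₁ q , (λ r le → Tnot⁻ (T∧₂ {lookup W0 f} q) (T∧ r (≤⇒≤ᵇ le)))
  where
    q : T (lookup W0 f ∧ not (lookup R f ∧ (t ≤ᵇ toℕ f)))
    q = setOf-elim (λ f → lookup W0 f ∧ not (lookup R f ∧ (t ≤ᵇ toℕ f))) p

dropFrom-intro : ∀ {n} (W0 R : Subset n) t f → T (lookup W0 f) → (T (lookup R f) → t ≤ toℕ f → ⊥) → T (lookup (dropFrom W0 R t) f)
dropFrom-intro W0 R t f p h = setOf-intro (λ f → lookup W0 f ∧ not (lookup R f ∧ (t ≤ᵇ toℕ f))) (T∧ p (Tnot (λ q → h (T∧₁ q) (≤ᵇ⇒≤ _ _ (T∧₂ {lookup R f} q)))))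

addBelow : ∀ {n} → Subset n → Subset n → ℕ → Subset n
addBelow X R t = setOf (λ f → lookup X f ∨ (lookup R f ∧ (toℕ f <ᵇ t)))

addBelow-step : ∀ {n} (X R : Subset n) (i : Fin n) → T (lookup R i) →
  addBelow X R (suc (toℕ i)) ≡ (addBelow X R (toℕ i) +e i)
addBelow-step X R i ri = subset-ext pt
  where
  pt : ∀ f → lookup (addBelow X R (suc (toℕ i))) f ≡ lookup (addBelow X R (toℕ i) +e i) f
  pt f rewrite lookup-setOf (λ f → lookup X f ∨ (lookup R f ∧ (toℕ f <ᵇ suc (toℕ i)))) f
             | lookup-+e (addBelow X R (toℕ i)) i f
             | lookup-setOf (λ f → lookup X f ∨ (lookup R f ∧ (toℕ f <ᵇ toℕ i))) f
             with i F.≟ f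
  ... | yes refl = trans l1 (sym r1)
    where
    l1 : (lookup X i ∨ (lookup R i ∧ (toℕ i <ᵇ suc (toℕ i)))) ≡ true
    l1 rewrite ls-self i | T≡ ri = ∨-zeroʳ _
    r1 : ((lookup X i ∨ (lookup R i ∧ (toℕ i <ᵇ toℕ i))) ∨ eqF i i) ≡ true
    r1 rewrite eqF-true i = ∨-zeroʳ _
  ... | no ne rewrite eqF-false ne | lt-neq ne = sym (∨-identityʳ _)

addBelow-skip : ∀ {n} (X R : Subset n) (i : Fin n) → (T (lookup R i) → ⊥) →
  addBelow X R (suc (toℕ i)) ≡ addBelow X R (toℕ i)
addBelow-skip X R i nr = subset-ext pt
  where
  pt : ∀ f → lookup (addBelow X R (suc (toℕ i))) f ≡ lookup (addBelow X R (toℕ i)) f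
  pt f rewrite lookup-setOf (λ f → lookup X f ∨ (lookup R f ∧ (toℕ f <ᵇ suc (toℕ i)))) f
             | lookup-setOf (λ f → lookup X f ∨ (lookup R f ∧ (toℕ f <ᵇ toℕ i))) f
             with i F.≟ f
  ... | yes refl with lookup R i in e
  ... | true = ⊥-elim (nr tt)
  ... | false = refl
  pt f | no ne rewrite lt-neq ne = refl

addBelow-0 : ∀ {n} (X R : Subset n) → addBelow X R 0 ≡ X
addBelow-0 X R = subset-ext pt
  where
  pt : ∀ f → lookup (addBelow X R 0) f ≡ lookup X f
  pt f rewrite lookup-setOf (λ f → lookup X f ∨ (lookup R f ∧ false)) f | ∧-zeroʳ (lookup R f) = ∨-identityʳ _

lookup-addBelow-n : ∀ {n} (X R : Subset n) f → lookup (addBelow X R n) f ≡ lookup X f ∨ lookup R f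
lookup-addBelow-n {n} X R f rewrite lookup-setOf (λ f → lookup X f ∨ (lookup R f ∧ (toℕ f <ᵇ n))) f | <ᵇ-true (toℕ<n f) | ∧-identityʳ (lookup R f) = refl

addBelow-elim : ∀ {n} (X R : Subset n) t f → T (lookup (addBelow X R t) f) → T (lookup X f) ⊎ (T (lookup R f) × toℕ f < t)
addBelow-elim X R t f p with T∨-elim {lookup X f} (setOf-elim (λ f → lookup X f ∨ (lookup R f ∧ (toℕ f <ᵇ t))) p)
... | inj₁ a = inj₁ a
... | inj₂ b = inj₂ (T∧₁ b , <ᵇ⇒< _ _ (T∧₂ {lookup R f} b))

addBelow-intro : ∀ {n} (X R : Subset n) t f → T (lookup X f) ⊎ (T (lookup R f) × toℕ f < t) → T (lookup (addBelow X R t) f)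
addBelow-intro X R t f (inj₁ a) = setOf-intro (λ f → lookup X f ∨ (lookup R f ∧ (toℕ f <ᵇ t))) (T∨₁ a)
addBelow-intro X R t f (inj₂ (a , b)) = setOf-intro (λ f → lookup X f ∨ (lookup R f ∧ (toℕ f <ᵇ t))) (T∨₂ {lookup X f} (T∧ a (<⇒<ᵇ b)))

countBelow : ∀ {n} → Subset n → ℕ → ℕ
countBelow R t = count (λ f → lookup R f ∧ (toℕ f <ᵇ t))

countBelow-step : ∀ {n} (R : Subset n) (i : Fin n) → T (lookup R i) → countBelow R (suc (toℕ i)) ≡ suc (countBelow R (toℕ i))
countBelow-step R i ri = trans (count-cong pt) (trans (count-∨ _ (eqF i) dj) (trans (cong (countBelow R (toℕ i) +_) (count-eqF i)) (+-comm _ 1)))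
  where
  pt : ∀ f → (lookup R f ∧ (toℕ f <ᵇ suc (toℕ i))) ≡ ((lookup R f ∧ (toℕ f <ᵇ toℕ i)) ∨ eqF i f)
  pt f with i F.≟ f
  ... | yes refl rewrite ls-self i | eqF-true i | T≡ ri = sym (∨-zeroʳ _)
  ... | no ne rewrite eqF-false ne | lt-neq ne = sym (∨-identityʳ _)
  dj : ∀ f → T (lookup R f ∧ (toℕ f <ᵇ toℕ i)) → T (eqF i f) → ⊥
  dj f p q with eqF-≡ i f q
  ... | refl = subst T (lt-self i) (T∧₂ {lookup R i} p)

countBelow-skip : ∀ {n} (R : Subset n) (i : Fin n) → (T (lookup R i) → ⊥) → countBelow R (suc (toℕ i)) ≡ countBelow R (toℕ i)
countBelow-skip R i nr = count-cong pt
  where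
  pt : ∀ f → (lookup R f ∧ (toℕ f <ᵇ suc (toℕ i))) ≡ (lookup R f ∧ (toℕ f <ᵇ toℕ i))
  pt f with i F.≟ f
  ... | yes refl with lookup R i in e
  ... | true = ⊥-elim (nr tt)
  ... | false = refl
  pt f | no ne rewrite lt-neq ne = refl

countBelow-n : ∀ {n} (R : Subset n) → countBelow R n ≡ ∣ R ∣
countBelow-n {n} R = trans (count-cong (λ f → trans (cong (lookup R f ∧_) (<ᵇ-true (toℕ<n f))) (∧-identityʳ _))) (sym (∣∣≡count R))

findFin : ∀ {n} (g : Fin n → Bool) → (∃ λ i → T (g i)) ⊎ (∀ i → T (g i) → ⊥)
findFin {zero} g = inj₂ (λ ())
findFin {suc n} g with Tdec (g zero)
... | inj₁ p = inj₁ (zero , p)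
... | inj₂ np with findFin (λ i → g (suc i))
... | inj₁ (i , p) = inj₁ (suc i , p)
... | inj₂ h = inj₂ (λ { zero p → np p ; (suc i) p → h i p })

module Sweeps {n} (N : Matroid n) where
  open Closure N

  -- If e ∈ cl(W0) and no element i of R lies in the closure of what remains
  -- of W0 (plus e) when i is removed, then e ∈ cl(W0 ∖ R); each step is an exchange.
  drop-keeps-closure : ∀ (W0 R : Subset n) e → R ⊑ W0 → (∀ i → T (lookup R i) → ¬ Cl i (dropFrom W0 R (toℕ i) +e e)) →
         Cl e W0 → Cl e (dropFrom W0 R 0)
  drop-keeps-closure W0 R e h hyp c = downward-induction (λ t → Cl e (dropFrom W0 R t)) base step 0
    where
    base : ∀ t → n ≤ t → Cl e (dropFrom W0 R t)
    base t h' = subst (Cl e) (sym (dropFrom-top W0 R t h')) c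
    step : ∀ (i : Fin n) → Cl e (dropFrom W0 R (suc (toℕ i))) → Cl e (dropFrom W0 R (toℕ i))
    step i p with Tdec (lookup R i)
    ... | inj₁ ri = exchange (subst (Cl e) (dropFrom-step W0 R i h ri) p) (hyp i ri)
    ... | inj₂ nr = subst (Cl e) (dropFrom-skip W0 R i nr) p

  drop-keeps-rank : ∀ (W0 R : Subset n) → R ⊑ W0 → (∀ j → T (lookup R j) → Cl j (dropFrom W0 R (toℕ j))) →
         ρ (dropFrom W0 R 0) ≡ ρ W0
  drop-keeps-rank W0 R h hyp = downward-induction (λ t → ρ (dropFrom W0 R t) ≡ ρ W0) base step 0
    where
    base : ∀ t → n ≤ t → ρ (dropFrom W0 R t) ≡ ρ W0
    base t h' = cong ρ (dropFrom-top W0 R t h')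
    step : ∀ (i : Fin n) → ρ (dropFrom W0 R (suc (toℕ i))) ≡ ρ W0 → ρ (dropFrom W0 R (toℕ i)) ≡ ρ W0
    step i p with Tdec (lookup R i)
    ... | inj₁ ri = trans (sym (hyp i ri)) (trans (cong ρ (sym (dropFrom-step W0 R i h ri))) p)
    ... | inj₂ nr = trans (cong ρ (sym (dropFrom-skip W0 R i nr))) p

  add-independent : ∀ (X R : Subset n) → (∀ i → T (lookup R i) → ¬ Cl i (addBelow X R (toℕ i))) →
         ∀ t → t ≤ n → ρ (addBelow X R t) ≡ ρ X + countBelow R t
  add-independent X R hyp = upward-induction (λ t → ρ (addBelow X R t) ≡ ρ X + countBelow R t) p0 step
    where
    p0 : ρ (addBelow X R 0) ≡ ρ X + countBelow R 0
    p0 = trans (cong ρ (addBelow-0 X R)) (sym (trans (cong (ρ X +_) (count-none _ (λ i p → subst T (∧-zeroʳ (lookup R i)) p))) (+-identityʳ _)))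
    step : ∀ (i : Fin n) → ρ (addBelow X R (toℕ i)) ≡ ρ X + countBelow R (toℕ i) → ρ (addBelow X R (suc (toℕ i))) ≡ ρ X + countBelow R (suc (toℕ i))
    step i p with Tdec (lookup R i)
    ... | inj₁ ri = trans (cong ρ (addBelow-step X R i ri)) (trans (¬Cl⇒rank+1 (hyp i ri)) (trans (cong suc p)
                      (trans (sym (+-suc (ρ X) _)) (cong (ρ X +_) (sym (countBelow-step R i ri))))))
    ... | inj₂ nr = trans (cong ρ (addBelow-skip X R i nr)) (trans p (cong (ρ X +_) (sym (countBelow-skip R i nr))))

  add-closed : ∀ (X R : Subset n) → (∀ i → T (lookup R i) → Cl i (addBelow X R (toℕ i))) →
         ∀ t → t ≤ n → ρ (addBelow X R t) ≡ ρ X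
  add-closed X R hyp = upward-induction (λ t → ρ (addBelow X R t) ≡ ρ X) (cong ρ (addBelow-0 X R)) step
    where
    step : ∀ (i : Fin n) → ρ (addBelow X R (toℕ i)) ≡ ρ X → ρ (addBelow X R (suc (toℕ i))) ≡ ρ X
    step i p with Tdec (lookup R i)
    ... | inj₁ ri = trans (cong ρ (addBelow-step X R i ri)) (trans (hyp i ri) p)
    ... | inj₂ nr = trans (cong ρ (addBelow-skip X R i nr)) p

  Clᵇ : Fin n → Subset n → Bool
  Clᵇ e X = ρ (X +e e) ≡ᵇ ρ X

  Clᵇ⇒Cl : ∀ {e X} → T (Clᵇ e X) → Cl e X
  Clᵇ⇒Cl {e} {X} p = ≡ᵇ⇒≡ _ _ p

  Cl⇒Clᵇ : ∀ {e X} → Cl e X → T (Clᵇ e X)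
  Cl⇒Clᵇ {e} {X} p = ≡⇒≡ᵇ _ _ p

  -- A dependent set has an element in the closure of the others: otherwise
  -- add-independent, applied to its elements in increasing order, shows it independent.
  dependent⇒closed-element : ∀ (Y : Subset n) → ρ Y < ∣ Y ∣ → ∃ λ y → T (lookup Y y) × Cl y (del Y y)
  dependent⇒closed-element Y lt with findFin (λ i → lookup Y i ∧ Clᵇ i (addBelow ∅ Y (toℕ i)))
  ... | inj₁ (i , p) = i , T∧₁ p , Cl-mono (setOf-⊑ _ sub1) (Clᵇ⇒Cl (T∧₂ {lookup Y i} p))
    where
    sub1 : ∀ f → T (lookup ∅ f ∨ (lookup Y f ∧ (toℕ f <ᵇ toℕ i))) → T (lookup (del Y i) f)
    sub1 f q with T∨-elim {lookup ∅ f} q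
    ... | inj₁ r = ⊥-elim (subst T (lookup-setOf (λ _ → false) f) r)
    ... | inj₂ r = del-in Y i f (T∧₁ r) (λ { refl → subst T (lt-self i) (T∧₂ {lookup Y i} r) })
  ... | inj₂ h = ⊥-elim (<-irrefl eqY lt)
    where
    eqY : ρ Y ≡ ∣ Y ∣
    eqY = begin
      ρ Y ≡⟨ cong ρ (sym (subset-ext (λ f → trans (lookup-addBelow-n ∅ Y f) (cong (_∨ lookup Y f) (lookup-setOf (λ _ → false) f))))) ⟩
      ρ (addBelow ∅ Y n) ≡⟨ add-independent ∅ Y (λ i ri c → h i (T∧ ri (Cl⇒Clᵇ c))) n ≤-refl ⟩
      ρ ∅ + countBelow Y n ≡⟨ cong₂ _+_ (≤-antisym (≤-trans (ρ≤ ∅) (≤-reflexive (trans (∣setOf∣ {n} (λ _ → false)) (count-none {n} (λ _ → false) (λ _ ()))))) z≤n) (countBelow-n Y) ⟩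
      ∣ Y ∣ ∎
      where open ≡-Reasoning

subsets-complete : ∀ {n} (Cc : Subset n) → Cc ∈L subsets n
subsets-complete [] = here refl
subsets-complete {suc n} (true ∷ Cc) = ∈-++⁺ˡ (∈-map⁺ (inside ∷_) (subsets-complete Cc))
subsets-complete {suc n} (false ∷ Cc) = ∈-++⁺ʳ (map (inside ∷_) (subsets n)) (∈-map⁺ (outside ∷_) (subsets-complete Cc))

all-elim : ∀ {a} {X : Set a} (p : X → Bool) {xs x} → T (L.all p xs) → x ∈L xs → T (p x)
all-elim p {y ∷ xs} h (here refl) = T∧₁ h
all-elim p {y ∷ xs} h (there m) = all-elim p (T∧₂ {p y} h) m

all-intro : ∀ {a} {X : Set a} (p : X → Bool) xs → (∀ x → x ∈L xs → T (p x)) → T (L.all p xs)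
all-intro p [] h = tt
all-intro p (x ∷ xs) h = T∧ (h x (here refl)) (all-intro p xs (λ y m → h y (there m)))

any-intro : ∀ {a} {X : Set a} (p : X → Bool) {xs x} → x ∈L xs → T (p x) → T (L.any p xs)
any-intro p {y ∷ xs} (here refl) q = T∨₁ q
any-intro p {y ∷ xs} (there m) q = T∨₂ {p y} (any-intro p m q)

any-elim : ∀ {a} {X : Set a} (p : X → Bool) xs → T (L.any p xs) → ∃ λ x → T (p x)
any-elim p (y ∷ xs) h with T∨-elim {p y} h
... | inj₁ q = y , q
... | inj₂ q = any-elim p xs q

⊆ᵇ→⊑ : ∀ {n} {A B : Subset n} → T (A ⊆ᵇ B) → A ⊑ B
⊆ᵇ→⊑ {n} {A} {B} h = incl (λ i p → go i p)
  where
  go : ∀ i → T (lookup A i) → T (lookup B i)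
  go i p with T∨-elim {not (lookup A i)} (all-elim (λ f → not (f ∈ᵇ A) ∨ (f ∈ᵇ B)) h (∈-allFin i))
  ... | inj₁ q = ⊥-elim (Tnot⁻ q p)
  ... | inj₂ q = q

⊑→⊆ᵇ : ∀ {n} {A B : Subset n} → A ⊑ B → T (A ⊆ᵇ B)
⊑→⊆ᵇ {n} {A} {B} h = all-intro (λ f → not (f ∈ᵇ A) ∨ (f ∈ᵇ B)) (allFin n) go
  where
  go : ∀ i → i ∈L allFin n → T (not (lookup A i) ∨ lookup B i)
  go i _ with Tdec (lookup A i)
  ... | inj₁ p = T∨₂ {not (lookup A i)} (at h i p)
  ... | inj₂ np = T∨₁ (Tnot np)

above : ∀ {n} → Subset n → Fin n → Subset n
above X e = setOf (λ f → lookup X f ∧ (suc (toℕ e) ≤ᵇ toℕ f))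

above-elim : ∀ {n} (X : Subset n) e f → T (lookup (above X e) f) → T (lookup X f) × toℕ e < toℕ f
above-elim X e f p = T∧₁ q , <ᵇ⇒< _ _ (T∧₂ {lookup X f} q)
  where
    q : T (lookup X f ∧ (suc (toℕ e) ≤ᵇ toℕ f))
    q = setOf-elim (λ f → lookup X f ∧ (suc (toℕ e) ≤ᵇ toℕ f)) p

above-intro : ∀ {n} (X : Subset n) e f → T (lookup X f) → toℕ e < toℕ f → T (lookup (above X e) f)
above-intro X e f p q = setOf-intro (λ f → lookup X f ∧ (suc (toℕ e) ≤ᵇ toℕ f)) (T∧ p (<⇒<ᵇ q))

above-mono : ∀ {n} {X Y : Subset n} e → X ⊑ Y → above X e ⊑ above Y e
above-mono {X = X} {Y} e h = incl (λ f p → above-intro Y e f (at h f (proj₁ (above-elim X e f p))) (proj₂ (above-elim X e f p)))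

-- belowOr X e = (X ∪ {f | f < e}) − e, the complement of e + above (E ∖ X) e.
belowOr : ∀ {n} → Subset n → Fin n → Subset n
belowOr A e = setOf (λ f → not (eqF e f) ∧ (lookup A f ∨ (toℕ f <ᵇ toℕ e)))

belowOr-elim : ∀ {n} (X : Subset n) e f → T (lookup (belowOr X e) f) → (e ≡ f → ⊥) × (T (lookup X f) ⊎ toℕ f < toℕ e)
belowOr-elim X e f p = (λ q → Tnot⁻ (T∧₁ rr) (subst (λ z → T (eqF e z)) q (eqF-refl e))) , g (T∨-elim {lookup X f} (T∧₂ {not (eqF e f)} rr))
  where
  rr : T (not (eqF e f) ∧ (lookup X f ∨ (toℕ f <ᵇ toℕ e)))
  rr = setOf-elim (λ f → not (eqF e f) ∧ (lookup X f ∨ (toℕ f <ᵇ toℕ e))) p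
  g : T (lookup X f) ⊎ T (toℕ f <ᵇ toℕ e) → T (lookup X f) ⊎ toℕ f < toℕ e
  g (inj₁ a) = inj₁ a
  g (inj₂ b) = inj₂ (<ᵇ⇒< _ _ b)

belowOr-intro : ∀ {n} (X : Subset n) e f → (e ≡ f → ⊥) → (T (lookup X f) ⊎ toℕ f < toℕ e) → T (lookup (belowOr X e) f)
belowOr-intro X e f ne q = setOf-intro (λ f → not (eqF e f) ∧ (lookup X f ∨ (toℕ f <ᵇ toℕ e))) (T∧ (Tnot (λ r → ne (eqF-≡ e f r))) (g q))
  where
  g : T (lookup X f) ⊎ toℕ f < toℕ e → T (lookup X f ∨ (toℕ f <ᵇ toℕ e))
  g (inj₁ a) = T∨₁ a
  g (inj₂ b) = T∨₂ {lookup X f} (<⇒<ᵇ b)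

module Circuits {n} (N : Matroid n) where
  open Closure N
  open Sweeps N

  smallestInCircuit : Fin n → Subset n → Subset n → Bool
  smallestInCircuit e X Cc = isCircuit N Cc ∧ (Cc ⊆ᵇ (X ∪ ⁅ e ⁆)) ∧ isMinOf e Cc

  circuit-closed : ∀ e Cc → T (isCircuit N Cc) → T (lookup Cc e) → Cl e (del Cc e)
  circuit-closed e Cc cr eC = ClD
    where
    D : Subset n
    D = del Cc e
    dep : ρ Cc < ∣ Cc ∣
    dep = <ᵇ⇒< _ _ (T∧₁ cr)
    allD : T (not (D ⊂ᵇ Cc) ∨ not (dependentR (rank N) D))
    allD = all-elim (λ D → not (D ⊂ᵇ Cc) ∨ not (dependentR (rank N) D)) (T∧₂ {dependentR (rank N) Cc} cr) (subsets-complete D)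
    DC : T (D ⊂ᵇ Cc)
    DC = T∧ (⊑→⊆ᵇ (del⊑ Cc e)) (<⇒<ᵇ (≤-reflexive (∣del∣ Cc e eC)))
    nd : ¬ (ρ D < ∣ D ∣)
    nd q with T∨-elim {not (D ⊂ᵇ Cc)} allD
    ... | inj₁ r = Tnot⁻ r DC
    ... | inj₂ r = Tnot⁻ r (<⇒<ᵇ q)
    ClD : Cl e D
    ClD = Cl-≤ (begin
      ρ (D +e e) ≡⟨ cong ρ (del+e Cc e eC) ⟩
      ρ Cc ≤⟨ ≤-pred (subst (suc (ρ Cc) ≤_) (sym (∣del∣ Cc e eC)) dep) ⟩
      ∣ D ∣ ≤⟨ ≮⇒≥ nd ⟩
      ρ D ∎)
      where open ≤-Reasoning

  circuit⇒closed-above : ∀ e X Cc → T (smallestInCircuit e X Cc) → Cl e (above X e)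
  circuit⇒closed-above e X Cc p = Cl-mono Dsub (circuit-closed e Cc cr eC)
    where
    cr : T (isCircuit N Cc)
    cr = T∧₁ p
    sb : T (Cc ⊆ᵇ (X ∪ ⁅ e ⁆))
    sb = T∧₁ (T∧₂ {isCircuit N Cc} p)
    mn : T (isMinOf e Cc)
    mn = T∧₂ {Cc ⊆ᵇ (X ∪ ⁅ e ⁆)} (T∧₂ {isCircuit N Cc} p)
    eC : T (lookup Cc e)
    eC = T∧₁ mn
    D : Subset n
    D = del Cc e
    Dsub : D ⊑ above X e
    Dsub = ⊑-setOf _ go
      where
      go : ∀ f → T (lookup D f) → T (lookup X f ∧ (suc (toℕ e) ≤ᵇ toℕ f))
      go f q = T∧ inX (≤⇒≤ᵇ (≤∧≢⇒< le (λ z → ne (toℕ-injective z))))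
        where
        fC : T (lookup Cc f)
        fC = at (del⊑ Cc e) f q
        ne : e ≡ f → ⊥
        ne = del-notin' Cc e f q
        inX : T (lookup X f)
        inX with in+e {X = X} {e} {f} (at (⊆ᵇ→⊑ {A = Cc} {B = X ∪ ⁅ e ⁆} sb) f fC)
        ... | inj₁ r = r
        ... | inj₂ r = ⊥-elim (ne r)
        le : toℕ e ≤ toℕ f
        le with T∨-elim {not (lookup Cc f)} (all-elim (λ f → not (f ∈ᵇ Cc) ∨ (toℕ e ≤ᵇ toℕ f)) (T∧₂ {lookup Cc e} mn) (∈-allFin f))
        ... | inj₁ r = ⊥-elim (Tnot⁻ r fC)
        ... | inj₂ r = ≤ᵇ⇒≤ _ _ r

  shrinkStep : Fin n → Fin n → Subset n → Subset n
  shrinkStep e f Y with lookup Y f ∧ Clᵇ e (del Y f)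
  ... | true = del Y f
  ... | false = Y

  shrinkStep-⊑ : ∀ e f Y → shrinkStep e f Y ⊑ Y
  shrinkStep-⊑ e f Y with lookup Y f ∧ Clᵇ e (del Y f)
  ... | true = del⊑ Y f
  ... | false = ⊑-refl

  shrinkStep-Cl : ∀ e f Y → Cl e Y → Cl e (shrinkStep e f Y)
  shrinkStep-Cl e f Y c with lookup Y f ∧ Clᵇ e (del Y f) in eq
  ... | true = Clᵇ⇒Cl (T∧₂ {lookup Y f} (≡T eq))
  ... | false = c

  shrinkStep-minimal : ∀ e f Y → T (lookup (shrinkStep e f Y) f) → ¬ Cl e (del (shrinkStep e f Y) f)
  shrinkStep-minimal e f Y with lookup Y f ∧ Clᵇ e (del Y f) in eq
  ... | true = λ p _ → del-notin Y f p
  ... | false = λ p c → subst T eq (T∧ p (Cl⇒Clᵇ c))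

  shrink : Fin n → List (Fin n) → Subset n → Subset n
  shrink e [] Y = Y
  shrink e (f ∷ fs) Y = shrink e fs (shrinkStep e f Y)

  shrink-⊑ : ∀ e fs Y → shrink e fs Y ⊑ Y
  shrink-⊑ e [] Y = ⊑-refl
  shrink-⊑ e (f ∷ fs) Y = ⊑-trans (shrink-⊑ e fs (shrinkStep e f Y)) (shrinkStep-⊑ e f Y)

  shrink-Cl : ∀ e fs Y → Cl e Y → Cl e (shrink e fs Y)
  shrink-Cl e [] Y c = c
  shrink-Cl e (f ∷ fs) Y c = shrink-Cl e fs (shrinkStep e f Y) (shrinkStep-Cl e f Y c)

  shrink-minimal : ∀ e fs Y f → f ∈L fs → T (lookup (shrink e fs Y) f) → ¬ Cl e (del (shrink e fs Y) f)
  shrink-minimal e (f ∷ fs) Y .f (here refl) p c =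
    shrinkStep-minimal e f Y (at (shrink-⊑ e fs (shrinkStep e f Y)) f p) (Cl-mono (del-mono f (shrink-⊑ e fs (shrinkStep e f Y))) c)
  shrink-minimal e (g ∷ fs) Y f (there m) p c = shrink-minimal e fs (shrinkStep e g Y) f m p c

  -- A dependent set all of whose one-point deletions are independent is a
  -- circuit (minimality only has to be checked against maximal proper subsets).
  circuit-intro : ∀ Cc → ρ Cc < ∣ Cc ∣ → (∀ f → T (lookup Cc f) → Ind (del Cc f)) → T (isCircuit N Cc)
  circuit-intro Cc dep indDel = T∧ (<⇒<ᵇ dep) (all-intro (λ D → not (D ⊂ᵇ Cc) ∨ not (dependentR (rank N) D)) (subsets n) go)
    where
    go : ∀ D → D ∈L subsets n → T (not (D ⊂ᵇ Cc) ∨ not (dependentR (rank N) D))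
    go D _ with Tdec (D ⊂ᵇ Cc)
    ... | inj₂ np = T∨₁ (Tnot np)
    ... | inj₁ p with findFin (λ f → lookup Cc f ∧ not (lookup D f))
    ... | inj₂ h = ⊥-elim (<⇒≱ (<ᵇ⇒< ∣ D ∣ ∣ Cc ∣ (T∧₂ {D ⊆ᵇ Cc} p)) (p⊆q⇒∣p∣≤∣q∣ (⊑→⊆ {A = Cc} {B = D} (incl Cc⊑D))))
      where
      Cc⊑D : ∀ i → T (lookup Cc i) → T (lookup D i)
      Cc⊑D i q with Tdec (lookup D i)
      ... | inj₁ r = r
      ... | inj₂ r = ⊥-elim (h i (T∧ q (Tnot r)))
    ... | inj₁ (f , q) = T∨₂ {not (D ⊂ᵇ Cc)} (Tnot (λ r → <-irrefl indD (<ᵇ⇒< _ _ r)))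
      where
      D⊑Cc-f : D ⊑ del Cc f
      D⊑Cc-f = incl (λ i r → del-in Cc f i (at (⊆ᵇ→⊑ {A = D} {B = Cc} (T∧₁ p)) i r) (λ { refl → Tnot⁻ (T∧₂ {lookup Cc f} q) r }))
      indD : Ind D
      indD = indep-⊑ D⊑Cc-f (indDel f (T∧₁ q))

  fundamental-circuit : ∀ Y e → Ind Y → (T (lookup Y e) → ⊥) → Cl e Y →
    (∀ f → T (lookup Y f) → ¬ Cl e (del Y f)) → T (isCircuit N (Y +e e))
  fundamental-circuit Y e indY e∉Y e∈clY minimal =
    circuit-intro (Y +e e) (subst₂ _<_ (sym (trans e∈clY indY)) (sym (∣+e∣ Y e e∉Y)) ≤-refl) indDel
    where
    indDel : ∀ f → T (lookup (Y +e e) f) → Ind (del (Y +e e) f)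
    indDel f fC with e F.≟ f
    ... | yes refl = subst Ind (sym delCe) indY
      where
      delCe : del (Y +e e) e ≡ Y
      delCe = ⊑-antisym (incl g1) (incl (λ i p → del-in (Y +e e) e i (at (⊑+e Y e) i p) (λ { refl → e∉Y p })))
        where
        g1 : ∀ i → T (lookup (del (Y +e e) e) i) → T (lookup Y i)
        g1 i p with in+e {X = Y} {e} {i} (at (del⊑ (Y +e e) e) i p)
        ... | inj₁ r = r
        ... | inj₂ r = ⊥-elim (del-notin' (Y +e e) e i p r)
    ... | no ne = subst Ind (sym eqs) ind2
      where
      fY : T (lookup Y f)
      fY with in+e {X = Y} {e} {f} fC
      ... | inj₁ r = r
      ... | inj₂ r = ⊥-elim (ne r)
      eqs : del (Y +e e) f ≡ (del Y f +e e)
      eqs = ⊑-antisym (incl g1) (+e⊑ (del-mono f (⊑+e Y e)) (del-in (Y +e e) f e (e∈+e Y e) (λ z → ne (sym z))))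
        where
        g1 : ∀ i → T (lookup (del (Y +e e) f) i) → T (lookup (del Y f +e e) i)
        g1 i p with in+e {X = Y} {e} {i} (at (del⊑ (Y +e e) f) i p)
        ... | inj₁ r = at (⊑+e (del Y f) e) i (del-in Y f i r (del-notin' (Y +e e) f i p))
        ... | inj₂ refl = e∈+e (del Y f) i
      ind2 : Ind (del Y f +e e)
      ind2 = trans (¬Cl⇒rank+1 (minimal f fY)) (trans (cong suc (indep-⊑ (del⊑ Y f) indY)) (sym (∣+e∣ (del Y f) e (λ q → e∉Y (at (del⊑ Y f) e q)))))

  -- If e ∉ Y0 lies in the closure of Y0, then e lies in a circuit inside Y0 + e:
  -- shrink Y0 to a minimal Y with e ∈ cl(Y); such a Y is independent.
  closed⇒circuit : ∀ e Y0 → (T (lookup Y0 e) → ⊥) → Cl e Y0 → ∃ λ Cc → T (isCircuit N Cc) × (Cc ⊑ (Y0 +e e)) × T (lookup Cc e)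
  closed⇒circuit e Y0 nY0 c = Y +e e , fundamental-circuit Y e Yind eY Ycl Ymin , +e-mono Ysub , e∈+e Y e
    where
    Y : Subset n
    Y = shrink e (allFin n) Y0
    Ysub : Y ⊑ Y0
    Ysub = shrink-⊑ e (allFin n) Y0
    Ycl : Cl e Y
    Ycl = shrink-Cl e (allFin n) Y0 c
    Ymin : ∀ f → T (lookup Y f) → ¬ Cl e (del Y f)
    Ymin f = shrink-minimal e (allFin n) Y0 f (∈-allFin f)
    eY : T (lookup Y e) → ⊥
    eY p = nY0 (at Ysub e p)
    Yind : Ind Y
    Yind with ρ Y Nat.<? ∣ Y ∣
    ... | no q = ≤-antisym (ρ≤ Y) (≮⇒≥ q)
    ... | yes q with dependent⇒closed-element Y q
    ... | y , yY , cy = ⊥-elim (Ymin y yY (Cl-trans cy (subst (Cl e) (sym (del+e Y y yY)) Ycl)))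

  -- Conversely, if e ∈ cl(above X e), the fundamental circuit of e gives a circuit
  -- inside X + e with smallest element e.
  closed-above⇒circuit : ∀ e X → Cl e (above X e) → T (L.any (smallestInCircuit e X) (subsets n))
  closed-above⇒circuit e X c with closed⇒circuit e (above X e) nY0 c
    where
    nY0 : T (lookup (above X e) e) → ⊥
    nY0 p = <-irrefl refl (≤ᵇ⇒≤ (suc (toℕ e)) (toℕ e) (T∧₂ {lookup X e} (setOf-elim (λ f → lookup X f ∧ (suc (toℕ e) ≤ᵇ toℕ f)) p)))
  ... | Cc , isC , Csub0 , eC = any-intro (smallestInCircuit e X) (subsets-complete Cc) (T∧ isC (T∧ (⊑→⊆ᵇ Csub) isM))
    where
    Yup : ∀ f → T (lookup (above X e) f) → suc (toℕ e) ≤ toℕ f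
    Yup f p = ≤ᵇ⇒≤ _ _ (T∧₂ {lookup X f} (setOf-elim (λ f → lookup X f ∧ (suc (toℕ e) ≤ᵇ toℕ f)) p))
    Csub : Cc ⊑ (X ∪ ⁅ e ⁆)
    Csub = ⊑-trans Csub0 (+e-mono (setOf-⊑ _ (λ f q → T∧₁ q)))
    isM : T (isMinOf e Cc)
    isM = T∧ eC (all-intro (λ f → not (f ∈ᵇ Cc) ∨ (toℕ e ≤ᵇ toℕ f)) (allFin n) go)
      where
      go : ∀ f → f ∈L allFin n → T (not (lookup Cc f) ∨ (toℕ e ≤ᵇ toℕ f))
      go f _ with Tdec (lookup Cc f)
      ... | inj₂ np = T∨₁ (Tnot np)
      ... | inj₁ p with in+e {X = above X e} {e} {f} (at Csub0 f p)
      ... | inj₁ r = T∨₂ {not (lookup Cc f)} (≤⇒≤ᵇ (<⇒≤ (Yup f r)))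
      ... | inj₂ refl = T∨₂ {not (lookup Cc e)} (≤⇒≤ᵇ (≤-refl {toℕ e}))

∣∪∣+∣∩∣ : ∀ {n} (A B : Subset n) → ∣ A ∪ B ∣ + ∣ A ∩ B ∣ ≡ ∣ A ∣ + ∣ B ∣
∣∪∣+∣∩∣ [] [] = refl
∣∪∣+∣∩∣ (true ∷ A) (true ∷ B) = cong suc (trans (+-suc _ _) (trans (cong suc (∣∪∣+∣∩∣ A B)) (sym (+-suc _ _))))
∣∪∣+∣∩∣ (true ∷ A) (false ∷ B) = cong suc (∣∪∣+∣∩∣ A B)
∣∪∣+∣∩∣ (false ∷ A) (true ∷ B) = trans (cong suc (∣∪∣+∣∩∣ A B)) (sym (+-suc _ _))
∣∪∣+∣∩∣ (false ∷ A) (false ∷ B) = ∣∪∣+∣∩∣ A B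

sumsub : ∀ {a b a' b' c} → c ≤ a → c ≤ b → c ≤ a' → c ≤ b' → a + b ≤ a' + b' → (a ∸ c) + (b ∸ c) ≤ (a' ∸ c) + (b' ∸ c)
sumsub {a} {b} {a'} {b'} {c} h1 h2 h3 h4 le = +-cancelʳ-≤ (c + c) _ _ (begin
  (a ∸ c + (b ∸ c)) + (c + c) ≡⟨ interch (a ∸ c) (b ∸ c) c ⟩
  (a ∸ c + c) + (b ∸ c + c) ≡⟨ cong₂ _+_ (m∸n+n≡m h1) (m∸n+n≡m h2) ⟩
  a + b ≤⟨ le ⟩
  a' + b' ≡⟨ sym (cong₂ _+_ (m∸n+n≡m h3) (m∸n+n≡m h4)) ⟩
  (a' ∸ c + c) + (b' ∸ c + c) ≡⟨ sym (interch (a' ∸ c) (b' ∸ c) c) ⟩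
  (a' ∸ c + (b' ∸ c)) + (c + c) ∎)
  where
  open ≤-Reasoning
  open +-*-Solver
  interch : ∀ x y z → (x + y) + (z + z) ≡ (x + z) + (y + z)
  interch = solve 3 (λ x y z → (x :+ y) :+ (z :+ z) := (x :+ z) :+ (y :+ z)) refl

module DualRank {n} (N : Matroid n) where
  open Closure N

  R : ℕ
  R = ρ ⊤

  -- r(E) ≤ |Z| + r(E ∖ Z), so the truncated subtraction in r* is exact.
  rank-E≤ : ∀ Z → R ≤ ∣ Z ∣ + ρ (∁ Z)
  rank-E≤ Z = begin
    ρ ⊤ ≤⟨ mono (incl (λ i _ → subst T (sym (trans (lookup-∪ Z (∁ Z) i) (cong (lookup Z i ∨_) (lookup-∁ Z i)))) (∨not (lookup Z i)))) ⟩
    ρ (Z ∪ ∁ Z) ≤⟨ subadd Z (∁ Z) ⟩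
    ρ Z + ρ (∁ Z) ≤⟨ +-monoˡ-≤ _ (ρ≤ Z) ⟩
    ∣ Z ∣ + ρ (∁ Z) ∎
    where
    open ≤-Reasoning
    ∨not : ∀ b → T (b ∨ not b)
    ∨not true = tt
    ∨not false = tt

  ⊑⊤ : ∀ {X : Subset n} → X ⊑ ⊤
  ⊑⊤ = incl (λ i _ → subst T (sym (lookup-⊤ i)) tt)

  dual-≤ : ∀ A → dualRank N A ≤ ∣ A ∣
  dual-≤ A = begin
    (∣ A ∣ + ρ (∁ A)) ∸ R ≤⟨ ∸-monoˡ-≤ R (+-monoʳ-≤ ∣ A ∣ (mono ⊑⊤)) ⟩
    (∣ A ∣ + R) ∸ R ≡⟨ m+n∸n≡m ∣ A ∣ R ⟩
    ∣ A ∣ ∎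
    where open ≤-Reasoning

  dual-mono : ∀ {A B} → A ⊆ B → dualRank N A ≤ dualRank N B
  dual-mono {A} {B} h0 = ∸-monoˡ-≤ R (begin
    ∣ A ∣ + ρ (∁ A) ≤⟨ +-monoʳ-≤ ∣ A ∣ (mono c1) ⟩
    ∣ A ∣ + ρ (∁ B ∪ D) ≤⟨ +-monoʳ-≤ ∣ A ∣ (subadd (∁ B) D) ⟩
    ∣ A ∣ + (ρ (∁ B) + ρ D) ≤⟨ +-monoʳ-≤ ∣ A ∣ (+-monoʳ-≤ (ρ (∁ B)) (ρ≤ D)) ⟩
    ∣ A ∣ + (ρ (∁ B) + ∣ D ∣) ≡⟨ solve1 (∣ A ∣) (ρ (∁ B)) (∣ D ∣) ⟩
    (∣ A ∣ + ∣ D ∣) + ρ (∁ B) ≡⟨ cong (_+ ρ (∁ B)) (sym cB) ⟩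
    ∣ B ∣ + ρ (∁ B) ∎)
    where
    open ≤-Reasoning
    h : A ⊑ B
    h = ⊆→⊑ h0
    fD : Fin n → Bool
    fD i = lookup B i ∧ not (lookup A i)
    D : Subset n
    D = setOf fD
    solve1 : ∀ x y z → x + (y + z) ≡ (x + z) + y
    solve1 = +-*-Solver.solve 3 (λ x y z → x :+ (y :+ z) := (x :+ z) :+ y) refl
      where open +-*-Solver
    c1 : ∁ A ⊑ (∁ B ∪ D)
    c1 = incl go
      where
      go : ∀ i → T (lookup (∁ A) i) → T (lookup (∁ B ∪ D) i)
      go i p with Tdec (lookup B i)
      ... | inj₁ b = at (∪-r (∁ B) D) i (setOf-intro fD (T∧ b (subst T (lookup-∁ A i) p)))
      ... | inj₂ nb = at (∪-l (∁ B) D) i (subst T (sym (lookup-∁ B i)) (Tnot nb))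
    cB : ∣ B ∣ ≡ ∣ A ∣ + ∣ D ∣
    cB = ∣∣-split B A D (λ i → bext (g1 i) (g2 i)) (λ i p q → Tnot⁻ (T∧₂ {lookup B i} (setOf-elim fD q)) p)
      where
      g1 : ∀ i → T (lookup B i) → T (lookup A i ∨ lookup D i)
      g1 i p with Tdec (lookup A i)
      ... | inj₁ a = T∨₁ a
      ... | inj₂ na = T∨₂ {lookup A i} (setOf-intro fD (T∧ p (Tnot na)))
      g2 : ∀ i → T (lookup A i ∨ lookup D i) → T (lookup B i)
      g2 i p with T∨-elim {lookup A i} p
      ... | inj₁ a = at h i a
      ... | inj₂ d = T∧₁ (setOf-elim fD d)

  dual-sub : ∀ A B → dualRank N (A ∪ B) + dualRank N (A ∩ B) ≤ dualRank N A + dualRank N B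
  dual-sub A B = sumsub (rank-E≤ (A ∪ B)) (rank-E≤ (A ∩ B)) (rank-E≤ A) (rank-E≤ B) (begin
    (∣ A ∪ B ∣ + ρ (∁ (A ∪ B))) + (∣ A ∩ B ∣ + ρ (∁ (A ∩ B))) ≡⟨ interch2 (∣ A ∪ B ∣) (ρ (∁ (A ∪ B))) (∣ A ∩ B ∣) (ρ (∁ (A ∩ B))) ⟩
    (∣ A ∪ B ∣ + ∣ A ∩ B ∣) + (ρ (∁ (A ∩ B)) + ρ (∁ (A ∪ B))) ≤⟨ +-mono-≤ (≤-reflexive (∣∪∣+∣∩∣ A B)) rs ⟩
    (∣ A ∣ + ∣ B ∣) + (ρ (∁ A) + ρ (∁ B)) ≡⟨ interch3 (∣ A ∣) (∣ B ∣) (ρ (∁ A)) (ρ (∁ B)) ⟩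
    (∣ A ∣ + ρ (∁ A)) + (∣ B ∣ + ρ (∁ B)) ∎)
    where
    open ≤-Reasoning
    open +-*-Solver
    interch2 : ∀ a b c d → (a + b) + (c + d) ≡ (a + c) + (d + b)
    interch2 = solve 4 (λ a b c d → (a :+ b) :+ (c :+ d) := (a :+ c) :+ (d :+ b)) refl
    interch3 : ∀ a b c d → (a + b) + (c + d) ≡ (a + c) + (b + d)
    interch3 = solve 4 (λ a b c d → (a :+ b) :+ (c :+ d) := (a :+ c) :+ (b :+ d)) refl
    p1 : ∀ i → lookup (∁ (A ∩ B)) i ≡ lookup (∁ A ∪ ∁ B) i
    p1 i rewrite lookup-∁ (A ∩ B) i | lookup-∩ A B i | lookup-∪ (∁ A) (∁ B) i | lookup-∁ A i | lookup-∁ B i with lookup A i | lookup B i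
    ... | true | true = refl
    ... | true | false = refl
    ... | false | true = refl
    ... | false | false = refl
    p2 : ∀ i → lookup (∁ (A ∪ B)) i ≡ lookup (∁ A ∩ ∁ B) i
    p2 i rewrite lookup-∁ (A ∪ B) i | lookup-∪ A B i | lookup-∩ (∁ A) (∁ B) i | lookup-∁ A i | lookup-∁ B i with lookup A i | lookup B i
    ... | true | true = refl
    ... | true | false = refl
    ... | false | true = refl
    ... | false | false = refl
    rs : ρ (∁ (A ∩ B)) + ρ (∁ (A ∪ B)) ≤ ρ (∁ A) + ρ (∁ B)
    rs = subst₂ (λ u v → ρ u + ρ v ≤ ρ (∁ A) + ρ (∁ B)) (sym (subset-ext p1)) (sym (subset-ext p2)) (rank-sub N (∁ A) (∁ B))

dual : ∀ {n} → Matroid n → Matroid n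
dual N = record { rank = dualRank N ; rank-≤ = DualRank.dual-≤ N ; rank-mono = DualRank.dual-mono N ; rank-sub = DualRank.dual-sub N }

externallyActive : ∀ {n} → Matroid n → Subset n → Fin n → Bool
externallyActive M A e = not (lookup A e) ∧ Sweeps.Clᵇ M e (above A e)

internallyActive : ∀ {n} → Matroid n → Subset n → Fin n → Bool
internallyActive M A e = lookup A e ∧ not (Sweeps.Clᵇ M e (belowOr A e))

ε≡#externallyActive : ∀ {n} (M : Matroid n) A → ε M A ≡ count (externallyActive M A)
ε≡#externallyActive {n} M A = trans (countB-allFin {n} _) (count-cong pt)
  where
  open Closure M
  open Sweeps M
  open Circuits M
  pt : ∀ e → (not (lookup A e) ∧ L.any (smallestInCircuit e A) (subsets n)) ≡ externallyActive M A e
  pt e with lookup A e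
  ... | true = refl
  ... | false = bext (λ p → Cl⇒Clᵇ (uncurry (circuit⇒closed-above e A) (any-elim (smallestInCircuit e A) (subsets n) p)))
                     (λ p → closed-above⇒circuit e A (Clᵇ⇒Cl p))

ltb-flip : ∀ {n} {e f : Fin n} → e ≢ f → (toℕ e <ᵇ toℕ f) ≡ not (toℕ f <ᵇ toℕ e)
ltb-flip {e = e} {f} ne with <-cmp (toℕ e) (toℕ f)
... | tri< a _ _ rewrite <ᵇ-true a | <ᵇ-false (<⇒≤ a) = refl
... | tri≈ _ b _ = ⊥-elim (ne (toℕ-injective b))
... | tri> _ _ c rewrite <ᵇ-true c | <ᵇ-false (<⇒≤ c) = refl

-- For e ∈ A: e ∈ cl*(above (E ∖ A) e) in the dual iff e ∉ cl(belowOr A e) in M,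
-- because (above (E ∖ A) e) + e and belowOr A e are complementary.
module DualClosure {n} (M : Matroid n) (A : Subset n) (e : Fin n) where
  D* : Matroid n
  D* = dual M
  module P = Closure M
  module Q = Closure D*
  Y : Subset n
  Y = above (∁ A) e
  W : Subset n
  W = belowOr A e

  fY : Fin n → Bool
  fY f = lookup (∁ A) f ∧ (suc (toℕ e) ≤ᵇ toℕ f)
  fW : Fin n → Bool
  fW f = not (eqF e f) ∧ (lookup A f ∨ (toℕ f <ᵇ toℕ e))

  cY : ∁ (Y +e e) ≡ W
  cY = subset-ext pt
    where
    pt : ∀ f → lookup (∁ (Y +e e)) f ≡ lookup W f
    pt f rewrite lookup-∁ (Y +e e) f | lookup-+e Y e f | lookup-setOf fY f | lookup-setOf fW f | lookup-∁ A f with e F.≟ f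
    ... | yes refl rewrite eqF-true e | ∨-zeroʳ (not (lookup A e) ∧ (toℕ e <ᵇ toℕ e)) = refl
    ... | no ne rewrite eqF-false ne | ∨-identityʳ (not (lookup A f) ∧ (toℕ e <ᵇ toℕ f)) | ltb-flip ne with lookup A f | toℕ f <ᵇ toℕ e
    ... | true | _ = refl
    ... | false | true = refl
    ... | false | false = refl

  c∁Y : ∁ Y ≡ (W +e e)
  c∁Y = subset-ext pt
    where
    pt : ∀ f → lookup (∁ Y) f ≡ lookup (W +e e) f
    pt f rewrite lookup-∁ Y f | lookup-+e W e f | lookup-setOf fY f | lookup-setOf fW f | lookup-∁ A f with e F.≟ f
    ... | yes refl rewrite eqF-true e | lt-self e | ∧-zeroʳ (not (lookup A e)) = sym (∨-zeroʳ (not true ∧ (lookup A e ∨ false)))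
    ... | no ne rewrite eqF-false ne | ltb-flip ne | ∨-identityʳ (not false ∧ (lookup A f ∨ (toℕ f <ᵇ toℕ e))) with lookup A f | toℕ f <ᵇ toℕ e
    ... | true | _ = refl
    ... | false | true = refl
    ... | false | false = refl

  eY : T (lookup Y e) → ⊥
  eY p = subst T (lt-self e) (T∧₂ {lookup (∁ A) e} (setOf-elim fY p))

  lhs : dualRank M (Y +e e) ≡ (suc ∣ Y ∣ + P.ρ W) ∸ P.ρ ⊤
  lhs = cong₂ (λ a b → (a + P.ρ b) ∸ P.ρ ⊤) (∣+e∣ Y e eY) cY

  rhs : dualRank M Y ≡ (∣ Y ∣ + P.ρ (W +e e)) ∸ P.ρ ⊤
  rhs = cong (λ b → (∣ Y ∣ + P.ρ b) ∸ P.ρ ⊤) c∁Y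

  to : Q.Cl e Y → ¬ P.Cl e W
  to q c = 1+n≢n (+-cancelˡ-≡ ∣ Y ∣ _ _ (trans (+-suc ∣ Y ∣ (P.ρ W)) (trans eq1 (cong (∣ Y ∣ +_) c))))
    where
    eq1 : suc ∣ Y ∣ + P.ρ W ≡ ∣ Y ∣ + P.ρ (W +e e)
    eq1 = ∸-cancelʳ-≡ (subst (λ z → P.ρ ⊤ ≤ suc ∣ Y ∣ + P.ρ z) cY (subst (λ z → P.ρ ⊤ ≤ z + P.ρ (∁ (Y +e e))) (∣+e∣ Y e eY) (DualRank.rank-E≤ M (Y +e e))))
                      (subst (λ z → P.ρ ⊤ ≤ ∣ Y ∣ + P.ρ z) c∁Y (DualRank.rank-E≤ M Y))
                      (trans (sym lhs) (trans q rhs))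

  from : ¬ P.Cl e W → Q.Cl e Y
  from nc = trans lhs (trans (cong (_∸ P.ρ ⊤) (trans (sym (+-suc ∣ Y ∣ (P.ρ W))) (cong (∣ Y ∣ +_) (sym (P.¬Cl⇒rank+1 nc))))) (sym rhs))

-- ι_M(A) counts the internally active elements: cocircuits are the circuits of
-- the dual, and DualClosure translates the dual closure condition.
ι≡#internallyActive : ∀ {n} (M : Matroid n) A → ι M A ≡ count (internallyActive M A)
ι≡#internallyActive {n} M A = trans (countB-allFin {n} _) (count-cong pt)
  where
  open Sweeps M using (Clᵇ⇒Cl; Cl⇒Clᵇ)
  open Circuits (dual M) using (smallestInCircuit; circuit⇒closed-above; closed-above⇒circuit)
  pt : ∀ e → (lookup A e ∧ L.any (smallestInCircuit e (∁ A)) (subsets n)) ≡ internallyActive M A e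
  pt e with lookup A e
  ... | false = refl
  ... | true = bext (λ p → Tnot (λ c → DualClosure.to M A e (uncurry (circuit⇒closed-above e (∁ A)) (any-elim (smallestInCircuit e (∁ A)) (subsets n) p)) (Clᵇ⇒Cl c)))
                    (λ p → closed-above⇒circuit e (∁ A) (DualClosure.from M A e (λ c → Tnot⁻ p (Cl⇒Clᵇ c))))

-- In a perspective M → M', closure in M implies closure in M': a circuit of M
-- through e contains a circuit of M' through e.
perspective-closure : ∀ {n} (M M' : Matroid n) → Perspective M M' → ∀ {e X} → Closure.Cl M e X → Closure.Cl M' e X
perspective-closure M M' pr {e} {X} c with Tdec (lookup X e)
... | inj₁ p = Closure.Cl-∈ M' p
... | inj₂ np with Circuits.closed⇒circuit M e X np c
... | Cc , isC , CX , eC with pr Cc isC e (T→∈ eC)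
... | C' , isC' , eC' , C'C = Closure.Cl-mono M' sb (Circuits.circuit-closed M' e C' isC' (∈→T eC'))
  where
  sb : del C' e ⊑ X
  sb = incl go
    where
    go : ∀ i → T (lookup (del C' e) i) → T (lookup X i)
    go i p with in+e {X = X} {e} {i} (at CX i (at (⊆→⊑ C'C) i (at (del⊑ C' e) i p)))
    ... | inj₁ r = r
    ... | inj₂ r = ⊥-elim (del-notin' C' e i p r)

belowOrAbove : ∀ {n} → Subset n → Fin n → Subset n
belowOrAbove A0 e = setOf (λ f → not (eqF e f) ∧ ((lookup A0 f ∧ (toℕ e <ᵇ toℕ f)) ∨ (toℕ f <ᵇ toℕ e)))

diffAbove : ∀ {n} → Subset n → Subset n → Fin n → Subset n
diffAbove X Y e = setOf (λ f → lookup X f ∧ not (lookup Y f) ∧ (toℕ e <ᵇ toℕ f))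

diff : ∀ {n} → Subset n → Subset n → Subset n
diff X Y = setOf (λ f → lookup X f ∧ not (lookup Y f))

inter : ∀ {n} → Subset n → Subset n → Subset n
inter X Y = setOf (λ f → lookup X f ∧ lookup Y f)

belowOrAbove-elim : ∀ {n} (X : Subset n) e f → T (lookup (belowOrAbove X e) f) → (e ≡ f → ⊥) × ((T (lookup X f) × toℕ e < toℕ f) ⊎ toℕ f < toℕ e)
belowOrAbove-elim X e f p = (λ q → Tnot⁻ (T∧₁ rr) (subst (λ z → T (eqF e z)) q (eqF-refl e))) , g (T∨-elim {lookup X f ∧ (toℕ e <ᵇ toℕ f)} (T∧₂ {not (eqF e f)} rr))
  where
  rr : T (not (eqF e f) ∧ ((lookup X f ∧ (toℕ e <ᵇ toℕ f)) ∨ (toℕ f <ᵇ toℕ e)))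
  rr = setOf-elim (λ f → not (eqF e f) ∧ ((lookup X f ∧ (toℕ e <ᵇ toℕ f)) ∨ (toℕ f <ᵇ toℕ e))) p
  g : T (lookup X f ∧ (toℕ e <ᵇ toℕ f)) ⊎ T (toℕ f <ᵇ toℕ e) → (T (lookup X f) × toℕ e < toℕ f) ⊎ toℕ f < toℕ e
  g (inj₁ a) = inj₁ (T∧₁ a , <ᵇ⇒< _ _ (T∧₂ {lookup X f} a))
  g (inj₂ b) = inj₂ (<ᵇ⇒< _ _ b)

belowOrAbove-intro : ∀ {n} (X : Subset n) e f → (e ≡ f → ⊥) → (T (lookup X f) × toℕ e < toℕ f) ⊎ toℕ f < toℕ e → T (lookup (belowOrAbove X e) f)
belowOrAbove-intro X e f ne (inj₁ (x , gt)) = setOf-intro (λ f → not (eqF e f) ∧ ((lookup X f ∧ (toℕ e <ᵇ toℕ f)) ∨ (toℕ f <ᵇ toℕ e))) (T∧ (Tnot (λ z → ne (eqF-≡ e f z))) (T∨₁ (T∧ x (<⇒<ᵇ gt))))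
belowOrAbove-intro X e f ne (inj₂ lt) = setOf-intro (λ f → not (eqF e f) ∧ ((lookup X f ∧ (toℕ e <ᵇ toℕ f)) ∨ (toℕ f <ᵇ toℕ e))) (T∧ (Tnot (λ z → ne (eqF-≡ e f z))) (T∨₂ {lookup X f ∧ (toℕ e <ᵇ toℕ f)} (<⇒<ᵇ lt)))

belowOrAbove-⊑-belowOr : ∀ {n} {X Y : Subset n} e → X ⊑ Y → belowOrAbove X e ⊑ belowOr Y e
belowOrAbove-⊑-belowOr {X = X} {Y} e h = incl go
  where
  go : ∀ f → T (lookup (belowOrAbove X e) f) → T (lookup (belowOr Y e) f)
  go f p with belowOrAbove-elim X e f p
  ... | ne , inj₁ (a , _) = belowOr-intro Y e f ne (inj₁ (at h f a))
  ... | ne , inj₂ b = belowOr-intro Y e f ne (inj₂ b)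

diffAbove-elim : ∀ {n} (X Y : Subset n) e f → T (lookup (diffAbove X Y e) f) → T (lookup X f) × (T (lookup Y f) → ⊥) × toℕ e < toℕ f
diffAbove-elim X Y e f p = T∧₁ q , Tnot⁻ (T∧₁ (T∧₂ {lookup X f} q)) , <ᵇ⇒< _ _ (T∧₂ {not (lookup Y f)} (T∧₂ {lookup X f} q))
  where
    q : T (lookup X f ∧ not (lookup Y f) ∧ (toℕ e <ᵇ toℕ f))
    q = setOf-elim (λ f → lookup X f ∧ not (lookup Y f) ∧ (toℕ e <ᵇ toℕ f)) p

diffAbove-intro : ∀ {n} (X Y : Subset n) e f → T (lookup X f) → (T (lookup Y f) → ⊥) → toℕ e < toℕ f → T (lookup (diffAbove X Y e) f)
diffAbove-intro X Y e f a b c = setOf-intro (λ f → lookup X f ∧ not (lookup Y f) ∧ (toℕ e <ᵇ toℕ f)) (T∧ a (T∧ (Tnot b) (<⇒<ᵇ c)))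

diff-elim : ∀ {n} (X Y : Subset n) f → T (lookup (diff X Y) f) → T (lookup X f) × (T (lookup Y f) → ⊥)
diff-elim X Y f p = T∧₁ q , Tnot⁻ (T∧₂ {lookup X f} q)
  where
    q : T (lookup X f ∧ not (lookup Y f))
    q = setOf-elim (λ f → lookup X f ∧ not (lookup Y f)) p

diff-intro : ∀ {n} (X Y : Subset n) f → T (lookup X f) → (T (lookup Y f) → ⊥) → T (lookup (diff X Y) f)
diff-intro X Y f a b = setOf-intro (λ f → lookup X f ∧ not (lookup Y f)) (T∧ a (Tnot b))

inter-elim : ∀ {n} (X Y : Subset n) f → T (lookup (inter X Y) f) → T (lookup X f) × T (lookup Y f)
inter-elim X Y f p = T∧₁ q , T∧₂ {lookup X f} q
  where
    q : T (lookup X f ∧ lookup Y f)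
    q = setOf-elim (λ f → lookup X f ∧ lookup Y f) p

inter-intro : ∀ {n} (X Y : Subset n) f → T (lookup X f) → T (lookup Y f) → T (lookup (inter X Y) f)
inter-intro X Y f a b = setOf-intro (λ f → lookup X f ∧ lookup Y f) (T∧ a b)

tailFrom : ∀ {n} → Subset n → ℕ → Subset n
tailFrom X t = setOf (λ f → lookup X f ∧ (t ≤ᵇ toℕ f))

tailFrom-elim : ∀ {n} (X : Subset n) t f → T (lookup (tailFrom X t) f) → T (lookup X f) × t ≤ toℕ f
tailFrom-elim X t f p = T∧₁ q , ≤ᵇ⇒≤ _ _ (T∧₂ {lookup X f} q)
  where
    q : T (lookup X f ∧ (t ≤ᵇ toℕ f))
    q = setOf-elim (λ f → lookup X f ∧ (t ≤ᵇ toℕ f)) p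

tailFrom-intro : ∀ {n} (X : Subset n) t f → T (lookup X f) → t ≤ toℕ f → T (lookup (tailFrom X t) f)
tailFrom-intro X t f a b = setOf-intro (λ f → lookup X f ∧ (t ≤ᵇ toℕ f)) (T∧ a (≤⇒≤ᵇ b))

tailFrom-mono : ∀ {n} {X Y : Subset n} t → X ⊑ Y → tailFrom X t ⊑ tailFrom Y t
tailFrom-mono {X = X} {Y} t h = incl (λ f p → tailFrom-intro Y t f (at h f (proj₁ (tailFrom-elim X t f p))) (proj₂ (tailFrom-elim X t f p)))

tailFrom-step : ∀ {n} (X : Subset n) i → T (lookup X i) → tailFrom X (toℕ i) ≡ (tailFrom X (suc (toℕ i)) +e i)
tailFrom-step X i xi = ⊑-antisym (incl g1) (+e⊑ (incl (λ f p → tailFrom-intro X (toℕ i) f (proj₁ (tailFrom-elim X _ f p)) (<⇒≤ (proj₂ (tailFrom-elim X _ f p))))) (tailFrom-intro X (toℕ i) i xi ≤-refl))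
  where
  g1 : ∀ f → T (lookup (tailFrom X (toℕ i)) f) → T (lookup (tailFrom X (suc (toℕ i)) +e i) f)
  g1 f p with tailFrom-elim X (toℕ i) f p | i F.≟ f
  ... | _ | yes refl = e∈+e (tailFrom X (suc (toℕ i))) i
  ... | xf , le | no ne = at (⊑+e (tailFrom X (suc (toℕ i))) i) f (tailFrom-intro X (suc (toℕ i)) f xf (≤∧≢⇒< le (λ q → ne (toℕ-injective q))))

tailFrom-skip : ∀ {n} (X : Subset n) i → (T (lookup X i) → ⊥) → tailFrom X (toℕ i) ≡ tailFrom X (suc (toℕ i))
tailFrom-skip X i nx = ⊑-antisym (incl g1) (incl (λ f p → tailFrom-intro X (toℕ i) f (proj₁ (tailFrom-elim X _ f p)) (<⇒≤ (proj₂ (tailFrom-elim X _ f p)))))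
  where
  g1 : ∀ f → T (lookup (tailFrom X (toℕ i)) f) → T (lookup (tailFrom X (suc (toℕ i))) f)
  g1 f p with tailFrom-elim X (toℕ i) f p | i F.≟ f
  ... | xf , _ | yes refl = ⊥-elim (nx xf)
  ... | xf , le | no ne = tailFrom-intro X (suc (toℕ i)) f xf (≤∧≢⇒< le (λ q → ne (toℕ-injective q)))

tailFrom-top : ∀ {n} (X : Subset n) t → n ≤ t → tailFrom X t ≡ ∅
tailFrom-top X t h = ⊑-antisym (incl (λ f p → ⊥-elim (<⇒≱ (toℕ<n f) (≤-trans h (proj₂ (tailFrom-elim X t f p)))))) (incl (λ f p → ⊥-elim (subst T (lookup-setOf (λ _ → false) f) p)))

tailFrom-0 : ∀ {n} (X : Subset n) → tailFrom X 0 ≡ X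
tailFrom-0 X = ⊑-antisym (incl (λ f p → proj₁ (tailFrom-elim X 0 f p))) (incl (λ f p → tailFrom-intro X 0 f p z≤n))

module Decomposition {n} (M M' : Matroid n) (pr : Perspective M M') where
  module P = Closure M
  module Q = Closure M'
  module PP = Sweeps M
  module QQ = Sweeps M'

  persp : ∀ {e X} → P.Cl e X → Q.Cl e X
  persp = perspective-closure M M' pr

  -- Let A0 ⊆ A be such that every j ∈ A ∖ A0 lies in cl_M(above A0 j).  Then A0
  -- carries the closure information of A: the rank of A (in M and M') and the relevant
  -- closures of the sets above and belowOr agree.  Each proof removes A ∖ A0 by a sweep.
  module CoreLemmas (A A0 : Subset n) (h0 : A0 ⊑ A) (nonCore-closed : ∀ j → T (lookup A j) → (T (lookup A0 j) → ⊥) → P.Cl j (above A0 j)) where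
    Rj : Fin n → Subset n
    Rj e = diffAbove A A0 e

    rank-above-core : ∀ e → P.ρ (above A0 e) ≡ P.ρ (above A e)
    rank-above-core e = trans (cong P.ρ (sym eqset)) (PP.drop-keeps-rank (above A e) (Rj e) Rsub hyp)
      where
      eqset : dropFrom (above A e) (Rj e) 0 ≡ above A0 e
      eqset = ⊑-antisym (incl g1) (incl g2)
        where
        g1 : ∀ f → T (lookup (dropFrom (above A e) (Rj e) 0) f) → T (lookup (above A0 e) f)
        g1 f p with dropFrom-elim (above A e) (Rj e) 0 f p
        ... | q , nr with above-elim A e f q | member? A0 f
        ... | a , lt | inj₁ a0 = above-intro A0 e f a0 lt
        ... | a , lt | inj₂ na0 = ⊥-elim (nr (diffAbove-intro A A0 e f a na0 lt) z≤n)
        g2 : ∀ f → T (lookup (above A0 e) f) → T (lookup (dropFrom (above A e) (Rj e) 0) f)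
        g2 f p with above-elim A0 e f p
        ... | a0 , lt = dropFrom-intro (above A e) (Rj e) 0 f (above-intro A e f (at h0 f a0) lt) (λ r _ → proj₁ (proj₂ (diffAbove-elim A A0 e f r)) a0)
      Rsub : Rj e ⊑ above A e
      Rsub = incl (λ f p → above-intro A e f (proj₁ (diffAbove-elim A A0 e f p)) (proj₂ (proj₂ (diffAbove-elim A A0 e f p))))
      hyp : ∀ j → T (lookup (Rj e) j) → P.Cl j (dropFrom (above A e) (Rj e) (toℕ j))
      hyp j rj with diffAbove-elim A A0 e j rj
      ... | aj , na0j , ej = P.Cl-mono (incl g) (nonCore-closed j aj na0j)
        where
        g : ∀ f → T (lookup (above A0 j) f) → T (lookup (dropFrom (above A e) (Rj e) (toℕ j)) f)
        g f p with above-elim A0 j f p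
        ... | a0 , lt = dropFrom-intro (above A e) (Rj e) (toℕ j) f (above-intro A e f (at h0 f a0) (<-trans ej lt)) (λ r _ → proj₁ (proj₂ (diffAbove-elim A A0 e f r)) a0)

    above-closure-core : ∀ e → P.Cl e (above A e) → P.Cl e (above A0 e)
    above-closure-core e c = P.Cl-transfer (above-mono e h0) (sym (rank-above-core e)) c

    belowOr-closure-core : ∀ e → Q.Cl e (belowOr A e) → Q.Cl e (belowOrAbove A0 e)
    belowOr-closure-core e c = Q.Cl-transfer (belowOrAbove-⊑-belowOr e h0) (sym (trans (cong Q.ρ (sym eqset)) (QQ.drop-keeps-rank (belowOr A e) (Rj e) Rsub hyp))) c
      where
      eqset : dropFrom (belowOr A e) (Rj e) 0 ≡ belowOrAbove A0 e
      eqset = ⊑-antisym (incl g1) (incl g2)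
        where
        g1 : ∀ f → T (lookup (dropFrom (belowOr A e) (Rj e) 0) f) → T (lookup (belowOrAbove A0 e) f)
        g1 f p with dropFrom-elim (belowOr A e) (Rj e) 0 f p
        ... | q , nr with belowOr-elim A e f q
        ... | ne , inj₂ lt = belowOrAbove-intro A0 e f ne (inj₂ lt)
        ... | ne , inj₁ a with trichotomy e f
        ... | inj₁ eq = ⊥-elim (ne eq)
        ... | inj₂ (inj₂ lt) = belowOrAbove-intro A0 e f ne (inj₂ lt)
        ... | inj₂ (inj₁ gt) with member? A0 f
        ... | inj₂ na0 = ⊥-elim (nr (diffAbove-intro A A0 e f a na0 gt) z≤n)
        ... | inj₁ a0 = belowOrAbove-intro A0 e f ne (inj₁ (a0 , gt))
        g2 : ∀ f → T (lookup (belowOrAbove A0 e) f) → T (lookup (dropFrom (belowOr A e) (Rj e) 0) f)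
        g2 f p with belowOrAbove-elim A0 e f p
        ... | ne , inj₁ (a0 , gt) = dropFrom-intro (belowOr A e) (Rj e) 0 f (belowOr-intro A e f ne (inj₁ (at h0 f a0))) (λ r _ → proj₁ (proj₂ (diffAbove-elim A A0 e f r)) a0)
        ... | ne , inj₂ lt = dropFrom-intro (belowOr A e) (Rj e) 0 f (belowOr-intro A e f ne (inj₂ lt)) (λ r _ → <-asym lt (proj₂ (proj₂ (diffAbove-elim A A0 e f r))))
      Rsub : Rj e ⊑ belowOr A e
      Rsub = incl (λ f p → belowOr-intro A e f (toℕ<⇒≢ (proj₂ (proj₂ (diffAbove-elim A A0 e f p)))) (inj₁ (proj₁ (diffAbove-elim A A0 e f p))))
      hyp : ∀ j → T (lookup (Rj e) j) → Q.Cl j (dropFrom (belowOr A e) (Rj e) (toℕ j))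
      hyp j rj with diffAbove-elim A A0 e j rj
      ... | aj , na0j , ej = Q.Cl-mono (incl g) (persp (nonCore-closed j aj na0j))
        where
        g : ∀ f → T (lookup (above A0 j) f) → T (lookup (dropFrom (belowOr A e) (Rj e) (toℕ j)) f)
        g f p with above-elim A0 j f p
        ... | a0 , lt = dropFrom-intro (belowOr A e) (Rj e) (toℕ j) f (belowOr-intro A e f (toℕ<⇒≢ (<-trans ej lt)) (inj₁ (at h0 f a0))) (λ r _ → proj₁ (proj₂ (diffAbove-elim A A0 e f r)) a0)

    eqA0 : dropFrom A (diff A A0) 0 ≡ A0
    eqA0 = ⊑-antisym (incl g1) (incl g2)
      where
      g1 : ∀ f → T (lookup (dropFrom A (diff A A0) 0) f) → T (lookup A0 f)
      g1 f p with dropFrom-elim A (diff A A0) 0 f p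
      ... | a , nr with member? A0 f
      ... | inj₁ a0 = a0
      ... | inj₂ na0 = ⊥-elim (nr (diff-intro A A0 f a na0) z≤n)
      g2 : ∀ f → T (lookup A0 f) → T (lookup (dropFrom A (diff A A0) 0) f)
      g2 f a0 = dropFrom-intro A (diff A A0) 0 f (at h0 f a0) (λ r _ → proj₂ (diff-elim A A0 f r) a0)

    DfA : diff A A0 ⊑ A
    DfA = incl (λ f p → proj₁ (diff-elim A A0 f p))

    subJ : ∀ j → T (lookup (diff A A0) j) → above A0 j ⊑ dropFrom A (diff A A0) (toℕ j)
    subJ j rj = incl (λ f p → dropFrom-intro A (diff A A0) (toℕ j) f (at h0 f (proj₁ (above-elim A0 j f p))) (λ r _ → proj₂ (diff-elim A A0 f r) (proj₁ (above-elim A0 j f p))))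

    rankM-core : P.ρ A ≡ P.ρ A0
    rankM-core = sym (trans (cong P.ρ (sym eqA0)) (PP.drop-keeps-rank A (diff A A0) DfA (λ j rj → P.Cl-mono (subJ j rj) (nonCore-closed j (proj₁ (diff-elim A A0 j rj)) (proj₂ (diff-elim A A0 j rj))))))

    rankM'-core : Q.ρ A ≡ Q.ρ A0
    rankM'-core = sym (trans (cong Q.ρ (sym eqA0)) (QQ.drop-keeps-rank A (diff A A0) DfA (λ j rj → Q.Cl-mono (subJ j rj) (persp (nonCore-closed j (proj₁ (diff-elim A A0 j rj)) (proj₂ (diff-elim A A0 j rj)))))))

  SpanIndep : Subset n → Set
  SpanIndep B = (Q.ρ B ≡ Q.ρ ⊤) × P.Ind B

  -- A lies in the interval of B: the elements of B ∖ A are internally active in M'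
  -- and the elements of A ∖ B externally active in M, with respect to B.
  InInterval : Subset n → Subset n → Set
  InInterval B A = (∀ f → T (lookup B f) → (T (lookup A f) → ⊥) → ¬ Q.Cl f (belowOr B f))
          × (∀ f → T (lookup A f) → (T (lookup B f) → ⊥) → P.Cl f (above B f))

  inCore : Subset n → Fin n → Bool
  inCore A e = lookup A e ∧ not (PP.Clᵇ e (above A e))

  isAdded : Subset n → Fin n → Bool
  isAdded A e = not (lookup A e) ∧ not (QQ.Clᵇ e (belowOr A e))

  canonicalBasis : Subset n → Subset n
  canonicalBasis A = setOf (λ e → inCore A e ∨ isAdded A e)

  ext-in : ∀ X f → T (externallyActive M X f) → (T (lookup X f) → ⊥) × P.Cl f (above X f)
  ext-in X f p = Tnot⁻ (T∧₁ p) , PP.Clᵇ⇒Cl (T∧₂ {not (lookup X f)} p)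

  ext-mk : ∀ X f → (T (lookup X f) → ⊥) → P.Cl f (above X f) → T (externallyActive M X f)
  ext-mk X f a b = T∧ (Tnot a) (PP.Cl⇒Clᵇ b)

  int-in : ∀ X f → T (internallyActive M' X f) → T (lookup X f) × ¬ Q.Cl f (belowOr X f)
  int-in X f p = T∧₁ p , (λ c → Tnot⁻ (T∧₂ {lookup X f} p) (QQ.Cl⇒Clᵇ c))

  int-mk : ∀ X f → T (lookup X f) → ¬ Q.Cl f (belowOr X f) → T (internallyActive M' X f)
  int-mk X f a b = T∧ a (Tnot (λ c → b (QQ.Clᵇ⇒Cl c)))

  spanning-closed : ∀ {B} f → Q.ρ B ≡ Q.ρ ⊤ → Q.Cl f B
  spanning-closed {B} f sp = Q.Cl-≤ (≤-trans (Q.mono {B +e f} {⊤} (incl (λ i _ → subst T (sym (lookup-⊤ {n} i)) tt))) (≤-reflexive (sym sp)))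

  ⊑-belowOr : ∀ (X : Subset n) f → (T (lookup X f) → ⊥) → X ⊑ belowOr X f
  ⊑-belowOr X f nf = incl (λ g p → belowOr-intro X f g (λ q → nf (subst (λ z → T (lookup X z)) (sym q) p)) (inj₁ p))

  above-⊑-belowOr : ∀ (X : Subset n) f → above X f ⊑ belowOr X f
  above-⊑-belowOr X f = incl (λ g p → belowOr-intro X f g (toℕ<⇒≢ (proj₂ (above-elim X f g p))) (inj₁ (proj₁ (above-elim X f g p))))

  above-⊑-del : ∀ (X B : Subset n) f → X ⊑ B → above X f ⊑ del B f
  above-⊑-del X B f h = incl (λ g p → del-in B f g (at h g (proj₁ (above-elim X f g p))) (toℕ<⇒≢ (proj₂ (above-elim X f g p))))

  module Interval (A B : Subset n) (spanIndep : SpanIndep B) (inInterval : InInterval B A) where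
    removed-internal : ∀ f → T (lookup B f) → (T (lookup A f) → ⊥) → ¬ Q.Cl f (belowOr B f)
    removed-internal = proj₁ inInterval
    added-external : ∀ f → T (lookup A f) → (T (lookup B f) → ⊥) → P.Cl f (above B f)
    added-external = proj₂ inInterval
    spanB : Q.ρ B ≡ Q.ρ ⊤
    spanB = proj₁ spanIndep
    indB : P.Ind B
    indB = proj₂ spanIndep
    A0 : Subset n
    A0 = inter A B
    A0A : A0 ⊑ A
    A0A = incl (λ f p → proj₁ (inter-elim A B f p))
    A0B : A0 ⊑ B
    A0B = incl (λ f p → proj₂ (inter-elim A B f p))

    -- Closures above e computed from B or from the core A0 agree: the removed
    -- elements of B ∖ A are internally active in M', hence (by the perspective)
    -- never in the closure that the exchange argument would need.
    above-closure-basis : ∀ e → P.Cl e (above B e) → P.Cl e (above A0 e)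
    above-closure-basis e c = subst (P.Cl e) eqset (PP.drop-keeps-closure (above B e) (diffAbove B A e) e Rsub hyp c)
      where
      Rsub : diffAbove B A e ⊑ above B e
      Rsub = incl (λ f p → above-intro B e f (proj₁ (diffAbove-elim B A e f p)) (proj₂ (proj₂ (diffAbove-elim B A e f p))))
      eqset : dropFrom (above B e) (diffAbove B A e) 0 ≡ above A0 e
      eqset = ⊑-antisym (incl g1) (incl g2)
        where
        g1 : ∀ f → T (lookup (dropFrom (above B e) (diffAbove B A e) 0) f) → T (lookup (above A0 e) f)
        g1 f p with dropFrom-elim (above B e) (diffAbove B A e) 0 f p
        ... | q , nr with above-elim B e f q | member? A f
        ... | b , lt | inj₁ a = above-intro A0 e f (inter-intro A B f a b) lt
        ... | b , lt | inj₂ na = ⊥-elim (nr (diffAbove-intro B A e f b na lt) z≤n)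
        g2 : ∀ f → T (lookup (above A0 e) f) → T (lookup (dropFrom (above B e) (diffAbove B A e) 0) f)
        g2 f p with above-elim A0 e f p
        ... | a0 , lt = dropFrom-intro (above B e) (diffAbove B A e) 0 f (above-intro B e f (at A0B f a0) lt) (λ r _ → proj₁ (proj₂ (diffAbove-elim B A e f r)) (at A0A f a0))
      hyp : ∀ i → T (lookup (diffAbove B A e) i) → ¬ P.Cl i (dropFrom (above B e) (diffAbove B A e) (toℕ i) +e e)
      hyp i ri c with diffAbove-elim B A e i ri
      ... | bi , nai , ei = removed-internal i bi nai (Q.Cl-mono (+e⊑ (incl g) (belowOr-intro B i e (λ q → toℕ<⇒≢ ei (sym q)) (inj₂ ei))) (persp c))
        where
        g : ∀ f → T (lookup (dropFrom (above B e) (diffAbove B A e) (toℕ i)) f) → T (lookup (belowOr B i) f)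
        g f p with dropFrom-elim (above B e) (diffAbove B A e) (toℕ i) f p
        ... | q , nr = belowOr-intro B i f (λ { refl → nr ri ≤-refl }) (inj₁ (proj₁ (above-elim B e f q)))

    nonCore-closed : ∀ j → T (lookup A j) → (T (lookup A0 j) → ⊥) → P.Cl j (above A0 j)
    nonCore-closed j aj na0 with member? B j
    ... | inj₁ bj = ⊥-elim (na0 (inter-intro A B j aj bj))
    ... | inj₂ nbj = above-closure-basis j (added-external j aj nbj)

    open CoreLemmas A A0 A0A nonCore-closed public

    belowOr-closure-basis : ∀ e → Q.Cl e (belowOr B e) → Q.Cl e (belowOrAbove A0 e)
    belowOr-closure-basis e c = subst (Q.Cl e) eqset (QQ.drop-keeps-closure (belowOr B e) (diffAbove B A e) e Rsub hyp c)
      where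
      Rsub : diffAbove B A e ⊑ belowOr B e
      Rsub = incl (λ f p → belowOr-intro B e f (toℕ<⇒≢ (proj₂ (proj₂ (diffAbove-elim B A e f p)))) (inj₁ (proj₁ (diffAbove-elim B A e f p))))
      eqset : dropFrom (belowOr B e) (diffAbove B A e) 0 ≡ belowOrAbove A0 e
      eqset = ⊑-antisym (incl g1) (incl g2)
        where
        g1 : ∀ f → T (lookup (dropFrom (belowOr B e) (diffAbove B A e) 0) f) → T (lookup (belowOrAbove A0 e) f)
        g1 f p with dropFrom-elim (belowOr B e) (diffAbove B A e) 0 f p
        ... | q , nr with belowOr-elim B e f q
        ... | ne , inj₂ lt = belowOrAbove-intro A0 e f ne (inj₂ lt)
        ... | ne , inj₁ b with trichotomy e f
        ... | inj₁ eq = ⊥-elim (ne eq)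
        ... | inj₂ (inj₂ lt) = belowOrAbove-intro A0 e f ne (inj₂ lt)
        ... | inj₂ (inj₁ gt) with member? A f
        ... | inj₂ na = ⊥-elim (nr (diffAbove-intro B A e f b na gt) z≤n)
        ... | inj₁ a = belowOrAbove-intro A0 e f ne (inj₁ (inter-intro A B f a b , gt))
        g2 : ∀ f → T (lookup (belowOrAbove A0 e) f) → T (lookup (dropFrom (belowOr B e) (diffAbove B A e) 0) f)
        g2 f p with belowOrAbove-elim A0 e f p
        ... | ne , inj₁ (a0 , gt) = dropFrom-intro (belowOr B e) (diffAbove B A e) 0 f (belowOr-intro B e f ne (inj₁ (at A0B f a0))) (λ r _ → proj₁ (proj₂ (diffAbove-elim B A e f r)) (at A0A f a0))
        ... | ne , inj₂ lt = dropFrom-intro (belowOr B e) (diffAbove B A e) 0 f (belowOr-intro B e f ne (inj₂ lt)) (λ r _ → <-asym lt (proj₂ (proj₂ (diffAbove-elim B A e f r))))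
      hyp : ∀ i → T (lookup (diffAbove B A e) i) → ¬ Q.Cl i (dropFrom (belowOr B e) (diffAbove B A e) (toℕ i) +e e)
      hyp i ri c with diffAbove-elim B A e i ri
      ... | bi , nai , ei = removed-internal i bi nai (Q.Cl-mono (+e⊑ (incl g) (belowOr-intro B i e (λ q → toℕ<⇒≢ ei (sym q)) (inj₂ ei))) c)
        where
        g : ∀ f → T (lookup (dropFrom (belowOr B e) (diffAbove B A e) (toℕ i)) f) → T (lookup (belowOr B i) f)
        g f p with dropFrom-elim (belowOr B e) (diffAbove B A e) (toℕ i) f p
        ... | q , nr with belowOr-elim B e f q
        ... | ne , inj₁ b = belowOr-intro B i f (λ { refl → nr ri ≤-refl }) (inj₁ b)
        ... | ne , inj₂ lt = belowOr-intro B i f (λ { refl → nr ri ≤-refl }) (inj₂ (<-trans lt ei))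

    canonicalBasis-interval : canonicalBasis A ≡ B
    canonicalBasis-interval = ⊑-antisym (incl g1) (incl g2)
      where
      fβ : Fin n → Bool
      fβ e = inCore A e ∨ isAdded A e
      g1 : ∀ f → T (lookup (canonicalBasis A) f) → T (lookup B f)
      g1 f p with member? B f
      ... | inj₁ b = b
      ... | inj₂ nb with T∨-elim {inCore A f} (setOf-elim fβ p)
      ... | inj₁ q = ⊥-elim (Tnot⁻ (T∧₂ {lookup A f} q) (PP.Cl⇒Clᵇ (P.Cl-mono (above-mono f A0A) (above-closure-basis f (added-external f (T∧₁ q) nb)))))
      ... | inj₂ q = ⊥-elim (Tnot⁻ (T∧₂ {not (lookup A f)} q) (QQ.Cl⇒Clᵇ (Q.Cl-mono (belowOrAbove-⊑-belowOr f A0A) (belowOr-closure-basis f (Q.Cl-mono (⊑-belowOr B f nb) (spanning-closed f spanB))))))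
      g2 : ∀ f → T (lookup B f) → T (lookup (canonicalBasis A) f)
      g2 f b with member? A f
      ... | inj₁ a = setOf-intro fβ (T∨₁ (T∧ a (Tnot (λ c → P.indep-not-closed indB b (above-⊑-del A0 B f A0B) (above-closure-core f (PP.Clᵇ⇒Cl c))))))
      ... | inj₂ na = setOf-intro fβ (T∨₂ {inCore A f} (T∧ (Tnot na) (Tnot (λ c → removed-internal f b na (Q.Cl-mono (belowOrAbove-⊑-belowOr f A0B) (belowOr-closure-core f (QQ.Clᵇ⇒Cl c)))))))

    removed : Subset n
    removed = diff B A
    added : Subset n
    added = diff A B

    cardA : ∣ A ∣ ≡ ∣ A0 ∣ + ∣ added ∣
    cardA = ∣∣-split A A0 added (λ f → bext (g1 f) (g2 f)) dj
      where
      g1 : ∀ f → T (lookup A f) → T (lookup A0 f ∨ lookup added f)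
      g1 f a with member? B f
      ... | inj₁ b = T∨₁ (inter-intro A B f a b)
      ... | inj₂ nb = T∨₂ {lookup A0 f} (diff-intro A B f a nb)
      g2 : ∀ f → T (lookup A0 f ∨ lookup added f) → T (lookup A f)
      g2 f p with T∨-elim {lookup A0 f} p
      ... | inj₁ q = at A0A f q
      ... | inj₂ q = proj₁ (diff-elim A B f q)
      dj : ∀ f → T (lookup A0 f) → T (lookup added f) → ⊥
      dj f p q = proj₂ (diff-elim A B f q) (at A0B f p)

    cardB : ∣ B ∣ ≡ ∣ A0 ∣ + ∣ removed ∣
    cardB = ∣∣-split B A0 removed (λ f → bext (g1 f) (g2 f)) dj
      where
      g1 : ∀ f → T (lookup B f) → T (lookup A0 f ∨ lookup removed f)
      g1 f b with member? A f
      ... | inj₁ a = T∨₁ (inter-intro A B f a b)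
      ... | inj₂ na = T∨₂ {lookup A0 f} (diff-intro B A f b na)
      g2 : ∀ f → T (lookup A0 f ∨ lookup removed f) → T (lookup B f)
      g2 f p with T∨-elim {lookup A0 f} p
      ... | inj₁ q = at A0B f q
      ... | inj₂ q = proj₁ (diff-elim B A f q)
      dj : ∀ f → T (lookup A0 f) → T (lookup removed f) → ⊥
      dj f p q = proj₂ (diff-elim B A f q) (at A0A f p)

    rA : P.ρ A ≡ ∣ A0 ∣
    rA = trans rankM-core (P.indep-⊑ A0B indB)

    r'B : Q.ρ B ≡ Q.ρ A0 + ∣ removed ∣
    r'B = trans (cong Q.ρ (sym eqU)) (trans (QQ.add-independent A0 removed hyp n ≤-refl) (cong (Q.ρ A0 +_) (countBelow-n removed)))
      where
      eqU : addBelow A0 removed n ≡ B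
      eqU = ⊑-antisym (incl g1) (incl g2)
        where
        g1 : ∀ f → T (lookup (addBelow A0 removed n) f) → T (lookup B f)
        g1 f p with addBelow-elim A0 removed n f p
        ... | inj₁ a0 = at A0B f a0
        ... | inj₂ (q , _) = proj₁ (diff-elim B A f q)
        g2 : ∀ f → T (lookup B f) → T (lookup (addBelow A0 removed n) f)
        g2 f b with member? A f
        ... | inj₁ a = addBelow-intro A0 removed n f (inj₁ (inter-intro A B f a b))
        ... | inj₂ na = addBelow-intro A0 removed n f (inj₂ (diff-intro B A f b na , toℕ<n f))
      hyp : ∀ i → T (lookup removed i) → ¬ Q.Cl i (addBelow A0 removed (toℕ i))
      hyp i ri c with diff-elim B A i ri
      ... | bi , nai = removed-internal i bi nai (Q.Cl-mono (incl g) c)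
        where
        g : ∀ f → T (lookup (addBelow A0 removed (toℕ i)) f) → T (lookup (belowOr B i) f)
        g f p with addBelow-elim A0 removed (toℕ i) f p
        ... | inj₁ a0 = belowOr-intro B i f (λ q → nai (subst (λ z → T (lookup A z)) (sym q) (at A0A f a0))) (inj₁ (at A0B f a0))
        ... | inj₂ (q , lt) = belowOr-intro B i f (λ q → <-irrefl (cong toℕ (sym q)) lt) (inj₁ (proj₁ (diff-elim B A f q)))

    nullity-A : ∣ A ∣ ∸ P.ρ A ≡ ∣ added ∣
    nullity-A = trans (cong₂ _∸_ cardA rA) (m+n∸m≡n ∣ A0 ∣ ∣ added ∣)

    corank-A : Q.ρ ⊤ ∸ Q.ρ A ≡ ∣ removed ∣
    corank-A = trans (cong₂ _∸_ (trans (sym spanB) r'B) rankM'-core) (m+n∸m≡n (Q.ρ A0) ∣ removed ∣)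

    -- r_M(A) − r_M'(A) = r_M(B) − r_M'(B), so rcd(A) = rcd(B).
    rank-balance : P.ρ A + Q.ρ B ≡ P.ρ B + Q.ρ A
    rank-balance = begin
      P.ρ A + Q.ρ B ≡⟨ cong₂ _+_ rA r'B ⟩
      ∣ A0 ∣ + (Q.ρ A0 + ∣ removed ∣) ≡⟨ sym (+-assoc ∣ A0 ∣ _ _) ⟩
      (∣ A0 ∣ + Q.ρ A0) + ∣ removed ∣ ≡⟨ cong (_+ ∣ removed ∣) (+-comm ∣ A0 ∣ _) ⟩
      (Q.ρ A0 + ∣ A0 ∣) + ∣ removed ∣ ≡⟨ +-assoc (Q.ρ A0) _ _ ⟩
      Q.ρ A0 + (∣ A0 ∣ + ∣ removed ∣) ≡⟨ +-comm (Q.ρ A0) _ ⟩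
      (∣ A0 ∣ + ∣ removed ∣) + Q.ρ A0 ≡⟨ cong₂ _+_ (trans (sym cardB) (sym indB)) (sym rankM'-core) ⟩
      P.ρ B + Q.ρ A ∎
      where open ≡-Reasoning

    #external-basis : count (externallyActive M B) ≡ count (externallyActive M A) + ∣ added ∣
    #external-basis = trans (count-cong (λ f → bext (g1 f) (g2 f))) (trans (count-∨ (externallyActive M A) (lookup added) dj) (cong (count (externallyActive M A) +_) (sym (∣∣≡count added))))
      where
      g1 : ∀ f → T (externallyActive M B f) → T (externallyActive M A f ∨ lookup added f)
      g1 f p with ext-in B f p
      ... | nb , c with member? A f
      ... | inj₁ a = T∨₂ {externallyActive M A f} (diff-intro A B f a nb)
      ... | inj₂ na = T∨₁ (ext-mk A f na (P.Cl-mono (above-mono f A0A) (above-closure-basis f c)))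
      g2 : ∀ f → T (externallyActive M A f ∨ lookup added f) → T (externallyActive M B f)
      g2 f p with T∨-elim {externallyActive M A f} p
      ... | inj₂ q = ext-mk B f (proj₂ (diff-elim A B f q)) (added-external f (proj₁ (diff-elim A B f q)) (proj₂ (diff-elim A B f q)))
      ... | inj₁ q with ext-in A f q
      ... | na , c with member? B f
      ... | inj₁ b = ⊥-elim (P.indep-not-closed indB b (above-⊑-del A0 B f A0B) (above-closure-core f c))
      ... | inj₂ nb = ext-mk B f nb (P.Cl-mono (above-mono f A0B) (above-closure-core f c))
      dj : ∀ f → T (externallyActive M A f) → T (lookup added f) → ⊥
      dj f p q = proj₁ (ext-in A f p) (proj₁ (diff-elim A B f q))

    #internal-basis : count (internallyActive M' B) ≡ count (internallyActive M' A) + ∣ removed ∣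
    #internal-basis = trans (count-cong (λ f → bext (g1 f) (g2 f))) (trans (count-∨ (internallyActive M' A) (lookup removed) dj) (cong (count (internallyActive M' A) +_) (sym (∣∣≡count removed))))
      where
      g1 : ∀ f → T (internallyActive M' B f) → T (internallyActive M' A f ∨ lookup removed f)
      g1 f p with int-in B f p
      ... | b , nc with member? A f
      ... | inj₂ na = T∨₂ {internallyActive M' A f} (diff-intro B A f b na)
      ... | inj₁ a = T∨₁ (int-mk A f a (λ c → nc (Q.Cl-mono (belowOrAbove-⊑-belowOr f A0B) (belowOr-closure-core f c))))
      g2 : ∀ f → T (internallyActive M' A f ∨ lookup removed f) → T (internallyActive M' B f)
      g2 f p with T∨-elim {internallyActive M' A f} p
      ... | inj₂ q = int-mk B f (proj₁ (diff-elim B A f q)) (removed-internal f (proj₁ (diff-elim B A f q)) (proj₂ (diff-elim B A f q)))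
      ... | inj₁ q with int-in A f q
      ... | a , nc with member? B f
      ... | inj₁ b = int-mk B f b (λ c → nc (Q.Cl-mono (belowOrAbove-⊑-belowOr f A0A) (belowOr-closure-basis f c)))
      ... | inj₂ nb = ⊥-elim (nc (Q.Cl-mono (above-⊑-belowOr A f) (Q.Cl-mono (above-mono f A0A) (persp (nonCore-closed f a (λ a0 → nb (at A0B f a0)))))))
      dj : ∀ f → T (internallyActive M' A f) → T (lookup removed f) → ⊥
      dj f p q = proj₂ (diff-elim B A f q) (proj₁ (int-in A f p))

  module Canonical (A : Subset n) where
    A0 : Subset n
    A0 = setOf (inCore A)
    I' : Subset n
    I' = setOf (isAdded A)
    B : Subset n
    B = canonicalBasis A
    A0-in : ∀ f → T (lookup A0 f) → T (lookup A f) × ¬ P.Cl f (above A f)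
    A0-in f p = T∧₁ q , (λ c → Tnot⁻ (T∧₂ {lookup A f} q) (PP.Cl⇒Clᵇ c))
      where
        q : T (inCore A f)
        q = setOf-elim (inCore A) p
    A0-mk : ∀ f → T (lookup A f) → ¬ P.Cl f (above A f) → T (lookup A0 f)
    A0-mk f a nc = setOf-intro (inCore A) (T∧ a (Tnot (λ c → nc (PP.Clᵇ⇒Cl c))))
    I-in : ∀ f → T (lookup I' f) → (T (lookup A f) → ⊥) × ¬ Q.Cl f (belowOr A f)
    I-in f p = Tnot⁻ (T∧₁ q) , (λ c → Tnot⁻ (T∧₂ {not (lookup A f)} q) (QQ.Cl⇒Clᵇ c))
      where
        q : T (isAdded A f)
        q = setOf-elim (isAdded A) p
    I-mk : ∀ f → (T (lookup A f) → ⊥) → ¬ Q.Cl f (belowOr A f) → T (lookup I' f)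
    I-mk f na nc = setOf-intro (isAdded A) (T∧ (Tnot na) (Tnot (λ c → nc (QQ.Clᵇ⇒Cl c))))
    B-in : ∀ f → T (lookup B f) → T (lookup A0 f) ⊎ T (lookup I' f)
    B-in f p with T∨-elim {inCore A f} (setOf-elim (λ e → inCore A e ∨ isAdded A e) p)
    ... | inj₁ q = inj₁ (setOf-intro (inCore A) q)
    ... | inj₂ q = inj₂ (setOf-intro (isAdded A) q)
    B-mk : ∀ f → T (lookup A0 f) ⊎ T (lookup I' f) → T (lookup B f)
    B-mk f (inj₁ q) = setOf-intro (λ e → inCore A e ∨ isAdded A e) (T∨₁ (setOf-elim (inCore A) q))
    B-mk f (inj₂ q) = setOf-intro (λ e → inCore A e ∨ isAdded A e) (T∨₂ {inCore A f} (setOf-elim (isAdded A) q))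
    A0A : A0 ⊑ A
    A0A = incl (λ f p → proj₁ (A0-in f p))
    A0B : A0 ⊑ B
    A0B = incl (λ f p → B-mk f (inj₁ p))
    IB : I' ⊑ B
    IB = incl (λ f p → B-mk f (inj₂ p))
    notA0 : ∀ f → T (lookup A f) → (T (lookup A0 f) → ⊥) → P.Cl f (above A f)
    notA0 f a na0 with P.Cl? f (above A f)
    ... | inj₁ c = c
    ... | inj₂ nc = ⊥-elim (na0 (A0-mk f a nc))

    tail-ranks-agree : ∀ t → P.ρ (tailFrom A t) ≡ P.ρ (tailFrom A0 t)
    tail-ranks-agree = downward-induction (λ t → P.ρ (tailFrom A t) ≡ P.ρ (tailFrom A0 t)) base step
      where
      base : ∀ t → n ≤ t → P.ρ (tailFrom A t) ≡ P.ρ (tailFrom A0 t)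
      base t h = cong P.ρ (trans (tailFrom-top A t h) (sym (tailFrom-top A0 t h)))
      step : ∀ (i : Fin n) → P.ρ (tailFrom A (suc (toℕ i))) ≡ P.ρ (tailFrom A0 (suc (toℕ i))) → P.ρ (tailFrom A (toℕ i)) ≡ P.ρ (tailFrom A0 (toℕ i))
      step i q with member? A i
      ... | inj₂ na = subst₂ (λ u v → P.ρ u ≡ P.ρ v) (sym (tailFrom-skip A i na)) (sym (tailFrom-skip A0 i (λ z → na (at A0A i z)))) q
      ... | inj₁ a with member? A0 i
      ... | inj₁ a0 = trans (cong P.ρ (tailFrom-step A i a)) (trans (P.rank-≡-∪ ⁅ i ⁆ (tailFrom-mono (suc (toℕ i)) A0A) q) (cong P.ρ (sym (tailFrom-step A0 i a0))))
      ... | inj₂ na0 = trans (cong P.ρ (tailFrom-step A i a)) (trans (notA0 i a na0) (trans q (cong P.ρ (sym (tailFrom-skip A0 i na0)))))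

    nonCore-closed : ∀ j → T (lookup A j) → (T (lookup A0 j) → ⊥) → P.Cl j (above A0 j)
    nonCore-closed j a na0 = P.Cl-transfer (above-mono j A0A) (tail-ranks-agree (suc (toℕ j))) (notA0 j a na0)

    open CoreLemmas A A0 A0A nonCore-closed public

    core-independent : P.Ind A0
    core-independent = subst (λ Z → P.ρ Z ≡ ∣ Z ∣) (tailFrom-0 A0) (downward-induction (λ t → P.ρ (tailFrom A0 t) ≡ ∣ tailFrom A0 t ∣) base step 0)
      where
      base : ∀ t → n ≤ t → P.ρ (tailFrom A0 t) ≡ ∣ tailFrom A0 t ∣
      base t h rewrite tailFrom-top A0 t h = trans (≤-antisym (≤-trans (P.ρ≤ ∅) (≤-reflexive e0)) z≤n) (sym e0)
        where
        e0 : ∣ ∅ {n} ∣ ≡ 0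
        e0 = trans (∣setOf∣ {n} (λ _ → false)) (count-none {n} (λ _ → false) (λ _ ()))
      step : ∀ (i : Fin n) → P.ρ (tailFrom A0 (suc (toℕ i))) ≡ ∣ tailFrom A0 (suc (toℕ i)) ∣ → P.ρ (tailFrom A0 (toℕ i)) ≡ ∣ tailFrom A0 (toℕ i) ∣
      step i q with member? A0 i
      ... | inj₂ na0 = subst (λ Z → P.ρ Z ≡ ∣ Z ∣) (sym (tailFrom-skip A0 i na0)) q
      ... | inj₁ a0 = subst (λ Z → P.ρ Z ≡ ∣ Z ∣) (sym (tailFrom-step A0 i a0))
                        (trans (P.¬Cl⇒rank+1 nc) (trans (cong suc q) (sym (∣+e∣ (tailFrom A0 (suc (toℕ i))) i (λ p → <-irrefl refl (proj₂ (tailFrom-elim A0 _ i p)))))))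
        where
        nc : ¬ P.Cl i (tailFrom A0 (suc (toℕ i)))
        nc c = proj₂ (A0-in i a0) (P.Cl-mono (above-mono i A0A) c)

    cardB : ∣ B ∣ ≡ ∣ A0 ∣ + ∣ I' ∣
    cardB = ∣∣-split B A0 I' (λ f → bext (λ p → g1 f (B-in f p)) (λ p → B-mk f (g2 f (T∨-elim {lookup A0 f} p)))) dj
      where
      g1 : ∀ f → T (lookup A0 f) ⊎ T (lookup I' f) → T (lookup A0 f ∨ lookup I' f)
      g1 f (inj₁ q) = T∨₁ q
      g1 f (inj₂ q) = T∨₂ {lookup A0 f} q
      g2 : ∀ f → T (lookup A0 f) ⊎ T (lookup I' f) → T (lookup A0 f) ⊎ T (lookup I' f)
      g2 f x = x
      dj : ∀ f → T (lookup A0 f) → T (lookup I' f) → ⊥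
      dj f p q = proj₁ (I-in f q) (proj₁ (A0-in f p))

    -- B is independent in M: the added elements are outside the closure of what
    -- precedes them, even in M'.
    indB : P.Ind B
    indB = trans (cong P.ρ (sym eqU)) (trans (PP.add-independent A0 I' hyp n ≤-refl) (trans (cong₂ _+_ core-independent (countBelow-n I')) (sym cardB)))
      where
      eqU : addBelow A0 I' n ≡ B
      eqU = ⊑-antisym (incl g1) (incl g2)
        where
        g1 : ∀ f → T (lookup (addBelow A0 I' n) f) → T (lookup B f)
        g1 f p with addBelow-elim A0 I' n f p
        ... | inj₁ a0 = B-mk f (inj₁ a0)
        ... | inj₂ (q , _) = B-mk f (inj₂ q)
        g2 : ∀ f → T (lookup B f) → T (lookup (addBelow A0 I' n) f)
        g2 f b with B-in f b
        ... | inj₁ a0 = addBelow-intro A0 I' n f (inj₁ a0)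
        ... | inj₂ q = addBelow-intro A0 I' n f (inj₂ (q , toℕ<n f))
      hyp : ∀ i → T (lookup I' i) → ¬ P.Cl i (addBelow A0 I' (toℕ i))
      hyp i ri c with I-in i ri
      ... | nai , nci = nci (Q.Cl-mono (incl g) (persp c))
        where
        g : ∀ f → T (lookup (addBelow A0 I' (toℕ i)) f) → T (lookup (belowOr A i) f)
        g f p with addBelow-elim A0 I' (toℕ i) f p
        ... | inj₁ a0 = belowOr-intro A i f (λ q → nai (subst (λ z → T (lookup A z)) (sym q) (at A0A f a0))) (inj₁ (at A0A f a0))
        ... | inj₂ (q , lt) = belowOr-intro A i f (λ q → <-irrefl (cong toℕ (sym q)) lt) (inj₂ lt)

    spanB : Q.ρ B ≡ Q.ρ ⊤
    spanB = trans (sym (QQ.add-closed B ⊤ hyp n ≤-refl)) (cong Q.ρ eqT)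
      where
      eqT : addBelow B ⊤ n ≡ ⊤
      eqT = ⊑-antisym (incl (λ f _ → subst T (sym (lookup-⊤ f)) tt)) (incl (λ f p → addBelow-intro B ⊤ n f (inj₂ (p , toℕ<n f))))
      hyp : ∀ i → T (lookup ⊤ i) → Q.Cl i (addBelow B ⊤ (toℕ i))
      hyp i _ with member? B i
      ... | inj₁ b = Q.Cl-∈ (addBelow-intro B ⊤ (toℕ i) i (inj₁ b))
      ... | inj₂ nb with member? A i
      ... | inj₁ a = Q.Cl-mono (incl g) (persp (nonCore-closed i a (λ a0 → nb (at A0B i a0))))
        where
        g : ∀ f → T (lookup (above A0 i) f) → T (lookup (addBelow B ⊤ (toℕ i)) f)
        g f p = addBelow-intro B ⊤ (toℕ i) f (inj₁ (at A0B f (proj₁ (above-elim A0 i f p))))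
      ... | inj₂ na = Q.Cl-mono (incl g) (belowOr-closure-core i cl')
        where
        cl' : Q.Cl i (belowOr A i)
        cl' with Q.Cl? i (belowOr A i)
        ... | inj₁ c = c
        ... | inj₂ nc = ⊥-elim (nb (B-mk i (inj₂ (I-mk i na nc))))
        g : ∀ f → T (lookup (belowOrAbove A0 i) f) → T (lookup (addBelow B ⊤ (toℕ i)) f)
        g f p with belowOrAbove-elim A0 i f p
        ... | _ , inj₁ (a0 , _) = addBelow-intro B ⊤ (toℕ i) f (inj₁ (at A0B f a0))
        ... | _ , inj₂ lt = addBelow-intro B ⊤ (toℕ i) f (inj₂ (subst T (sym (lookup-⊤ f)) tt , lt))

    spanIndep : SpanIndep B
    spanIndep = spanB , indB

    A∖B-external : ∀ f → T (lookup A f) → (T (lookup B f) → ⊥) → P.Cl f (above B f)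
    A∖B-external f a nb = P.Cl-mono (above-mono f A0B) (nonCore-closed f a (λ a0 → nb (at A0B f a0)))

    -- Elements of B ∖ A are internally active in M' with respect to B: deleting
    -- the later added elements from belowOr B f lands inside belowOr A f,
    -- and none of those deletions can create the closure relation.
    B∖A-internal : ∀ f → T (lookup B f) → (T (lookup A f) → ⊥) → ¬ Q.Cl f (belowOr B f)
    B∖A-internal f b na c = nci (Q.Cl-mono (incl g0) (QQ.drop-keeps-closure (belowOr B f) R f Rsub hyp c))
      where
      nci : ¬ Q.Cl f (belowOr A f)
      nci with B-in f b
      ... | inj₁ a0 = ⊥-elim (na (at A0A f a0))
      ... | inj₂ q = proj₂ (I-in f q)
      R : Subset n
      R = above I' f
      Rsub : R ⊑ belowOr B f
      Rsub = incl (λ g p → belowOr-intro B f g (toℕ<⇒≢ (proj₂ (above-elim I' f g p))) (inj₁ (at IB g (proj₁ (above-elim I' f g p)))))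
      g0 : ∀ g → T (lookup (dropFrom (belowOr B f) R 0) g) → T (lookup (belowOr A f) g)
      g0 g p with dropFrom-elim (belowOr B f) R 0 g p
      ... | q , nr with belowOr-elim B f g q
      ... | ne , inj₂ lt = belowOr-intro A f g ne (inj₂ lt)
      ... | ne , inj₁ bg with trichotomy f g
      ... | inj₁ eq = ⊥-elim (ne eq)
      ... | inj₂ (inj₂ lt) = belowOr-intro A f g ne (inj₂ lt)
      ... | inj₂ (inj₁ gt) with B-in g bg
      ... | inj₁ a0 = belowOr-intro A f g ne (inj₁ (at A0A g a0))
      ... | inj₂ ig = ⊥-elim (nr (above-intro I' f g ig gt) z≤n)
      hyp : ∀ i → T (lookup R i) → ¬ Q.Cl i (dropFrom (belowOr B f) R (toℕ i) +e f)
      hyp i ri c with above-elim I' f i ri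
      ... | ii , fi = proj₂ (I-in i ii) (Q.Cl-mono (+e⊑ (incl g) (belowOr-intro A i f (λ q → toℕ<⇒≢ fi (sym q)) (inj₂ fi))) c)
        where
        g : ∀ g → T (lookup (dropFrom (belowOr B f) R (toℕ i)) g) → T (lookup (belowOr A i) g)
        g g p with dropFrom-elim (belowOr B f) R (toℕ i) g p
        ... | q , nr with belowOr-elim B f g q
        ... | ne , inj₂ lt = belowOr-intro A i g (λ z → nr (subst (λ w → T (lookup R w)) z ri) (≤-reflexive (cong toℕ z))) (inj₂ (<-trans lt fi))
        ... | ne , inj₁ bg with trichotomy i g
        ... | inj₁ eq = ⊥-elim (nr (subst (λ w → T (lookup R w)) eq ri) (≤-reflexive (cong toℕ eq)))
        ... | inj₂ (inj₂ lt) = belowOr-intro A i g (λ z → <-irrefl (cong toℕ (sym z)) lt) (inj₂ lt)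
        ... | inj₂ (inj₁ gt) with B-in g bg
        ... | inj₁ a0 = belowOr-intro A i g (toℕ<⇒≢ gt) (inj₁ (at A0A g a0))
        ... | inj₂ ig = ⊥-elim (nr (above-intro I' f g ig (<-trans fi gt)) (<⇒≤ gt))

    inInterval : InInterval B A
    inInterval = B∖A-internal , A∖B-external

indicator : Bool → ℕ
indicator true = 1
indicator false = 0

sumOver : ∀ {a} {X : Set a} → (X → ℕ) → List X → ℕ
sumOver f [] = 0
sumOver f (x ∷ xs) = f x + sumOver f xs

countB≡sumOver : ∀ {a} {X : Set a} (p : X → Bool) xs → countB p xs ≡ sumOver (λ x → indicator (p x)) xs
countB≡sumOver p [] = refl
countB≡sumOver p (x ∷ xs) with p x
... | true = cong suc (countB≡sumOver p xs)
... | false = countB≡sumOver p xs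

countB-++ : ∀ {a} {X : Set a} (p : X → Bool) xs ys → countB p (xs ++ ys) ≡ countB p xs + countB p ys
countB-++ p [] ys = refl
countB-++ p (x ∷ xs) ys with p x
... | true = cong suc (countB-++ p xs ys)
... | false = countB-++ p xs ys

countB-map : ∀ {a b} {X : Set a} {Y : Set b} (p : Y → Bool) (f : X → Y) xs → countB p (map f xs) ≡ countB (λ x → p (f x)) xs
countB-map p f [] = refl
countB-map p f (x ∷ xs) with p (f x)
... | true = cong suc (countB-map p f xs)
... | false = countB-map p f xs

countB-cong : ∀ {a} {X : Set a} {p q : X → Bool} xs → (∀ x → p x ≡ q x) → countB p xs ≡ countB q xs
countB-cong {p = p} {q} [] h = refl
countB-cong {p = p} {q} (x ∷ xs) h with p x | q x | h x
... | true | true | refl = cong suc (countB-cong xs h)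
... | false | false | refl = countB-cong xs h

countB-false : ∀ {a} {X : Set a} (p : X → Bool) xs → (∀ x → T (p x) → ⊥) → countB p xs ≡ 0
countB-false p [] h = refl
countB-false p (x ∷ xs) h with p x in e
... | true = ⊥-elim (h x (≡T e))
... | false = countB-false p xs h

countB-c∧ : ∀ {a} {X : Set a} (c : Bool) (p : X → Bool) xs → countB (λ x → c ∧ p x) xs ≡ indicator c * countB p xs
countB-c∧ true p xs = sym (+-identityʳ _)
countB-c∧ false p xs = countB-false (λ _ → false) xs (λ _ ())

sumOver-cong : ∀ {a} {X : Set a} {f g : X → ℕ} xs → (∀ x → f x ≡ g x) → sumOver f xs ≡ sumOver g xs
sumOver-cong [] h = refl
sumOver-cong (x ∷ xs) h = cong₂ _+_ (h x) (sumOver-cong xs h)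

sumOver-scale : ∀ {a} {X : Set a} (c : ℕ) (f : X → ℕ) xs → sumOver (λ x → c * f x) xs ≡ c * sumOver f xs
sumOver-scale c f [] = sym (*-zeroʳ c)
sumOver-scale c f (x ∷ xs) = trans (cong (c * f x +_) (sumOver-scale c f xs)) (sym (*-distribˡ-+ c (f x) _))

sumOver-+ : ∀ {a} {X : Set a} (f g : X → ℕ) xs → sumOver (λ x → f x + g x) xs ≡ sumOver f xs + sumOver g xs
sumOver-+ f g [] = refl
sumOver-+ f g (x ∷ xs) = trans (cong (f x + g x +_) (sumOver-+ f g xs)) (ic (f x) (g x) (sumOver f xs) (sumOver g xs))
  where
  open +-*-Solver
  ic : ∀ a b c d → (a + b) + (c + d) ≡ (a + c) + (b + d)
  ic = solve 4 (λ a b c d → (a :+ b) :+ (c :+ d) := (a :+ c) :+ (b :+ d)) refl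

sumOver-0 : ∀ {a} {X : Set a} (xs : List X) → sumOver (λ _ → 0) xs ≡ 0
sumOver-0 [] = refl
sumOver-0 (x ∷ xs) = sumOver-0 xs

countB-cons : ∀ {a} {X : Set a} (p : X → Bool) x xs → countB p (x ∷ xs) ≡ indicator (p x) + countB p xs
countB-cons p x xs with p x
... | true = refl
... | false = refl

sum-swap : ∀ {a b} {X : Set a} {Y : Set b} (g : X → Y → Bool) xs ys →
  sumOver (λ x → countB (g x) ys) xs ≡ sumOver (λ y → countB (λ x → g x y) xs) ys
sum-swap g [] ys = sym (sumOver-0 ys)
sum-swap g (x ∷ xs) ys = begin
  countB (g x) ys + sumOver (λ x → countB (g x) ys) xs ≡⟨ cong₂ _+_ (countB≡sumOver (g x) ys) (sum-swap g xs ys) ⟩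
  sumOver (λ y → indicator (g x y)) ys + sumOver (λ y → countB (λ x → g x y) xs) ys ≡⟨ sym (sumOver-+ _ _ ys) ⟩
  sumOver (λ y → indicator (g x y) + countB (λ x → g x y) xs) ys ≡⟨ sumOver-cong ys (λ y → sym (countB-cons (λ x → g x y) x xs)) ⟩
  sumOver (λ y → countB (λ x → g x y) (x ∷ xs)) ys ∎
  where open ≡-Reasoning

indicator-true : ∀ {b} → T b → indicator b ≡ 1
indicator-true {true} _ = refl

indicator-false : ∀ {b} → (T b → ⊥) → indicator b ≡ 0
indicator-false {false} _ = refl
indicator-false {true} h = ⊥-elim (h tt)

fibre-counting : ∀ {a b} {X : Set a} {Y : Set b} (P : X → Bool) (Q : Y → Bool) (β : X → Y) (same : Y → Y → Bool)
  (c : ℕ) xs ys → (∀ x → countB (same (β x)) ys ≡ 1) →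
  (∀ y → countB (λ x → P x ∧ same (β x) y) xs ≡ c * indicator (Q y)) →
  countB P xs ≡ c * countB Q ys
fibre-counting P Q β same c xs ys unique fibre = begin
  countB P xs ≡⟨ countB≡sumOver P xs ⟩
  sumOver (λ x → indicator (P x)) xs ≡⟨ sumOver-cong xs fibre-of ⟩
  sumOver (λ x → countB (λ y → P x ∧ same (β x) y) ys) xs ≡⟨ sum-swap (λ x y → P x ∧ same (β x) y) xs ys ⟩
  sumOver (λ y → countB (λ x → P x ∧ same (β x) y) xs) ys ≡⟨ sumOver-cong ys fibre ⟩
  sumOver (λ y → c * indicator (Q y)) ys ≡⟨ sumOver-scale c (λ y → indicator (Q y)) ys ⟩
  c * sumOver (λ y → indicator (Q y)) ys ≡⟨ cong (c *_) (sym (countB≡sumOver Q ys)) ⟩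
  c * countB Q ys ∎
  where
  open ≡-Reasoning
  fibre-of : ∀ x → indicator (P x) ≡ countB (λ y → P x ∧ same (β x) y) ys
  fibre-of x = sym (begin
    countB (λ y → P x ∧ same (β x) y) ys ≡⟨ countB-c∧ (P x) (same (β x)) ys ⟩
    indicator (P x) * countB (same (β x)) ys ≡⟨ cong (indicator (P x) *_) (unique x) ⟩
    indicator (P x) * 1 ≡⟨ *-identityʳ _ ⟩
    indicator (P x) ∎)

sameBit : Bool → Bool → Bool
sameBit true true = true
sameBit false false = true
sameBit _ _ = false

sameSet : ∀ {n} → Subset n → Subset n → Bool
sameSet [] [] = true
sameSet (x ∷ X) (y ∷ Y) = sameBit x y ∧ sameSet X Y

sameSet-refl : ∀ {n} (X : Subset n) → T (sameSet X X)
sameSet-refl [] = tt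
sameSet-refl (true ∷ X) = sameSet-refl X
sameSet-refl (false ∷ X) = sameSet-refl X

sameSet⇒≡ : ∀ {n} (X Y : Subset n) → T (sameSet X Y) → X ≡ Y
sameSet⇒≡ [] [] _ = refl
sameSet⇒≡ (true ∷ X) (true ∷ Y) p = cong (true ∷_) (sameSet⇒≡ X Y p)
sameSet⇒≡ (false ∷ X) (false ∷ Y) p = cong (false ∷_) (sameSet⇒≡ X Y p)

sameSet-unique : ∀ {n} (X : Subset n) → countB (sameSet X) (subsets n) ≡ 1
sameSet-unique [] = refl
sameSet-unique {suc n} (true ∷ X) = trans (countB-++ (sameSet (true ∷ X)) (map (inside ∷_) (subsets n)) (map (outside ∷_) (subsets n)))
  (trans (cong₂ _+_ (trans (countB-map _ _ (subsets n)) (sameSet-unique X)) (trans (countB-map _ _ (subsets n)) (countB-false _ (subsets n) (λ _ ())))) refl)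
sameSet-unique {suc n} (false ∷ X) = trans (countB-++ (sameSet (false ∷ X)) (map (inside ∷_) (subsets n)) (map (outside ∷_) (subsets n)))
  (trans (cong₂ _+_ (trans (countB-map _ _ (subsets n)) (countB-false _ (subsets n) (λ _ ()))) (trans (countB-map _ _ (subsets n)) (sameSet-unique X))) refl)

allF : ∀ {n} → (Fin n → Bool) → Bool
allF {zero} g = true
allF {suc n} g = g zero ∧ allF (λ i → g (suc i))

allF-T : ∀ {n} (g : Fin n → Bool) → T (allF g) → ∀ f → T (g f)
allF-T {suc n} g p zero = T∧₁ p
allF-T {suc n} g p (suc f) = allF-T (λ i → g (suc i)) (T∧₂ {g zero} p) f

allF-mk : ∀ {n} (g : Fin n → Bool) → (∀ f → T (g f)) → T (allF g)
allF-mk {zero} g h = tt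
allF-mk {suc n} g h = T∧ (h zero) (allF-mk (λ i → g (suc i)) (λ f → h (suc f)))

intervalAt : ∀ {n} → Subset n → Subset n → Subset n → Subset n → Fin n → Bool
intervalAt B I J A f = (not (lookup B f ∧ not (lookup A f)) ∨ lookup I f) ∧ (not (lookup A f ∧ not (lookup B f)) ∨ lookup J f)

intervalWithSizes : ∀ {n} → Subset n → Subset n → Subset n → ℕ → ℕ → Subset n → Bool
intervalWithSizes B I J p q A = allF (intervalAt B I J A) ∧ (∣ diff B A ∣ ≡ᵇ p) ∧ (∣ diff A B ∣ ≡ᵇ q)

pascal : ∀ i p J → (i C suc p) * J + (i C p) * J ≡ (suc i C suc p) * J
pascal i p J = trans (sym (*-distribʳ-+ J (i C suc p) (i C p))) (cong (_* J) (trans (+-comm (i C suc p) (i C p)) (nCk+nC[k+1]≡[n+1]C[k+1] i p)))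

pascal' : ∀ I j q → I * (j C suc q) + I * (j C q) ≡ I * (suc j C suc q)
pascal' I j q = trans (sym (*-distribˡ-+ I (j C suc q) (j C q))) (cong (I *_) (trans (+-comm (j C suc q) (j C q)) (nCk+nC[k+1]≡[n+1]C[k+1] j q)))

interval-count : ∀ {n} (B I J : Subset n) → (∀ f → T (lookup I f) → T (lookup B f)) → (∀ f → T (lookup J f) → T (lookup B f) → ⊥) → ∀ p q →
  countB (intervalWithSizes B I J p q) (subsets n) ≡ (count (lookup I) C p) * (count (lookup J) C q)
interval-count [] [] [] hu hv zero zero = refl
interval-count [] [] [] hu hv zero (suc q) = refl
interval-count [] [] [] hu hv (suc p) zero = refl
interval-count [] [] [] hu hv (suc p) (suc q) = refl
interval-count {suc m} (b ∷ B) (u0 ∷ I) (v0 ∷ J) hu hv p q =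
  trans (countB-++ (intervalWithSizes (b ∷ B) (u0 ∷ I) (v0 ∷ J) p q) (map (inside ∷_) (subsets m)) (map (outside ∷_) (subsets m)))
  (trans (cong₂ _+_ (countB-map _ _ (subsets m)) (countB-map _ _ (subsets m))) (cases b u0 v0 hu hv p q))
  where
  hu' : ∀ f → T (lookup I f) → T (lookup B f)
  hu' f = hu (suc f)
  hv' : ∀ f → T (lookup J f) → T (lookup B f) → ⊥
  hv' f = hv (suc f)
  IH : ∀ p q → countB (intervalWithSizes B I J p q) (subsets m) ≡ (count (lookup I) C p) * (count (lookup J) C q)
  IH = interval-count B I J hu' hv'
  S : List (Subset m)
  S = subsets m
  Z : ∀ (P : Subset m → Bool) → (∀ A → T (P A) → ⊥) → countB P S ≡ 0
  Z P h = countB-false P S h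
  cases : ∀ b u0 v0 → (∀ f → T (lookup (u0 ∷ I) f) → T (lookup (b ∷ B) f)) → (∀ f → T (lookup (v0 ∷ J) f) → T (lookup (b ∷ B) f) → ⊥) → ∀ p q →
    countB (λ A → intervalWithSizes (b ∷ B) (u0 ∷ I) (v0 ∷ J) p q (true ∷ A)) S + countB (λ A → intervalWithSizes (b ∷ B) (u0 ∷ I) (v0 ∷ J) p q (false ∷ A)) S
      ≡ (count (lookup (u0 ∷ I)) C p) * (count (lookup (v0 ∷ J)) C q)
  cases false true v0 hu hv p q = ⊥-elim (hu zero tt)
  cases true u0 true hu hv p q = ⊥-elim (hv zero tt tt)
  cases true true false hu hv zero q = trans (cong₂ _+_ (IH zero q) (Z _ (λ A r → T∧₁ {false} {∣ diff A B ∣ ≡ᵇ q} (T∧₂ {allF (intervalAt B I J A)} r)))) (+-identityʳ _)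
  cases true true false hu hv (suc p) q = trans (cong₂ _+_ (IH (suc p) q) (IH p q)) (pascal (count (lookup I)) p (count (lookup J) C q))
  cases true false false hu hv p q = trans (cong₂ _+_ (IH p q) (Z _ (λ A ()))) (+-identityʳ _)
  cases false false true hu hv p zero = trans (cong₂ _+_ (Z _ (λ A r → T∧₂ {∣ diff B A ∣ ≡ᵇ p} (T∧₂ {allF (intervalAt B I J A)} r))) (IH p zero)) refl
  cases false false true hu hv p (suc q) = trans (cong₂ _+_ (IH p q) (IH p (suc q))) (trans (+-comm ((count (lookup I) C p) * (count (lookup J) C q)) _) (pascal' (count (lookup I) C p) (count (lookup J)) q))
  cases false false false hu hv p q = cong₂ _+_ (Z _ (λ A ())) (IH p q)

⊖-eq : ∀ a b c d → a + d ≡ c + b → a ⊖ b ≡ c ⊖ d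
⊖-eq a b c d h = begin
  a ⊖ b ≡⟨ sym (ℤP.+-cancelˡ-⊖ d a b) ⟩
  (d + a) ⊖ (d + b) ≡⟨ cong₂ _⊖_ (trans (+-comm d a) (trans h (+-comm c b))) (+-comm d b) ⟩
  (b + c) ⊖ (b + d) ≡⟨ ℤP.+-cancelˡ-⊖ b c d ⟩
  c ⊖ d ∎
  where open ≡-Reasoning

T≡ℤᵇ⇒≡ : ∀ {x y : ℤ} → T (x ≡ℤᵇ y) → x ≡ y
T≡ℤᵇ⇒≡ {x} {y} p = toWitness {a? = x ℤ.≟ y} p

≡⇒T≡ℤᵇ : ∀ {x y : ℤ} → x ≡ y → T (x ≡ℤᵇ y)
≡⇒T≡ℤᵇ {x} {y} p = fromWitness {a? = x ℤ.≟ y} p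

T≡ᵇ⇒≡ : ∀ {x y} → T (x ≡ᵇ y) → x ≡ y
T≡ᵇ⇒≡ {x} {y} = ≡ᵇ⇒≡ x y

≡⇒T≡ᵇ : ∀ {x y} → x ≡ y → T (x ≡ᵇ y)
≡⇒T≡ᵇ {x} {y} = ≡⇒≡ᵇ x y

split∧ : ∀ {x y} → T (x ∧ y) → T x × T y
split∧ {x} p = T∧₁ p , T∧₂ {x} p

rcd-cong : ∀ {n} (M M' : Matroid n) A B → rank M A + rank M' B ≡ rank M B + rank M' A → rcd M M' A ≡ rcd M M' B
rcd-cong M M' A B h = cong (λ z → ((ℤ.+ r M) -ℤ (ℤ.+ r M')) -ℤ z) (begin
  ℤ.+ rank M A -ℤ ℤ.+ rank M' A ≡⟨ ℤP.[+m]-[+n]≡m⊖n (rank M A) (rank M' A) ⟩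
  rank M A ⊖ rank M' A ≡⟨ ⊖-eq (rank M A) (rank M' A) (rank M B) (rank M' B) h ⟩
  rank M B ⊖ rank M' B ≡⟨ sym (ℤP.[+m]-[+n]≡m⊖n (rank M B) (rank M' B)) ⟩
  ℤ.+ rank M B -ℤ ℤ.+ rank M' B ∎)
  where open ≡-Reasoning

module Counting {n} (M M' : Matroid n) (pr : Perspective M M') (i j k p q : ℕ) (p≤i : p ≤ i) (q≤j : q ≤ j) where
  open Decomposition M M' pr

  countedA : Subset n → Bool
  countedA A = (ι M' A ≡ᵇ (i ∸ p)) ∧ (ε M A ≡ᵇ (j ∸ q)) ∧ (rcd M M' A ≡ℤᵇ (ℤ.+ k))
       ∧ ((r M' ∸ rank M' A) ≡ᵇ p) ∧ ((∣ A ∣ ∸ rank M A) ≡ᵇ q)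

  record CountedA (A : Subset n) : Set where
    field
      ι-A : ι M' A ≡ i ∸ p
      ε-A : ε M A ≡ j ∸ q
      rcd-A : rcd M M' A ≡ ℤ.+ k
      corank-A≡p : r M' ∸ rank M' A ≡ p
      nullity-A≡q : ∣ A ∣ ∸ rank M A ≡ q

  decodeA : ∀ {A} → T (countedA A) → CountedA A
  decodeA {A} t with split∧ {ι M' A ≡ᵇ (i ∸ p)} t
  ... | t1 , r1 with split∧ {ε M A ≡ᵇ (j ∸ q)} r1
  ... | t2 , r2 with split∧ {rcd M M' A ≡ℤᵇ (ℤ.+ k)} r2
  ... | t3 , r3 with split∧ {(r M' ∸ rank M' A) ≡ᵇ p} r3
  ... | t4 , t5 = record { ι-A = T≡ᵇ⇒≡ t1 ; ε-A = T≡ᵇ⇒≡ t2 ; rcd-A = T≡ℤᵇ⇒≡ t3 ; corank-A≡p = T≡ᵇ⇒≡ t4 ; nullity-A≡q = T≡ᵇ⇒≡ t5 }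

  encodeA : ∀ {A} → CountedA A → T (countedA A)
  encodeA c = T∧ (≡⇒T≡ᵇ ι-A) (T∧ (≡⇒T≡ᵇ ε-A) (T∧ (≡⇒T≡ℤᵇ rcd-A) (T∧ (≡⇒T≡ᵇ corank-A≡p) (≡⇒T≡ᵇ nullity-A≡q))))
    where open CountedA c

  countedB : Subset n → Bool
  countedB B = (rank M' B ≡ᵇ r M') ∧ (rank M B ≡ᵇ ∣ B ∣)
       ∧ (ι M' B ≡ᵇ i) ∧ (ε M B ≡ᵇ j) ∧ (rcd M M' B ≡ℤᵇ (ℤ.+ k))

  record CountedB (B : Subset n) : Set where
    field
      spanIndep-B : SpanIndep B
      ι-B : ι M' B ≡ i
      ε-B : ε M B ≡ j
      rcd-B : rcd M M' B ≡ ℤ.+ k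

  decodeB : ∀ {B} → T (countedB B) → CountedB B
  decodeB {B} t with split∧ {rank M' B ≡ᵇ r M'} t
  ... | t1 , r1 with split∧ {rank M B ≡ᵇ ∣ B ∣} r1
  ... | t2 , r2 with split∧ {ι M' B ≡ᵇ i} r2
  ... | t3 , r3 with split∧ {ε M B ≡ᵇ j} r3
  ... | t4 , t5 = record { spanIndep-B = T≡ᵇ⇒≡ t1 , T≡ᵇ⇒≡ t2 ; ι-B = T≡ᵇ⇒≡ t3 ; ε-B = T≡ᵇ⇒≡ t4 ; rcd-B = T≡ℤᵇ⇒≡ t5 }

  encodeB : ∀ {B} → CountedB B → T (countedB B)
  encodeB c = T∧ (≡⇒T≡ᵇ (proj₁ spanIndep-B)) (T∧ (≡⇒T≡ᵇ (proj₂ spanIndep-B)) (T∧ (≡⇒T≡ᵇ ι-B) (T∧ (≡⇒T≡ᵇ ε-B) (≡⇒T≡ℤᵇ rcd-B))))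
    where open CountedB c

  -- If A lies in the interval of B and is counted by a, then B is counted by b:
  -- passing from A to B adds |B∖A| = p internally and |A∖B| = q externally
  -- active elements and leaves rcd unchanged.
  interval-countedA⇒countedB : ∀ A B → (si : SpanIndep B) → InInterval B A → CountedA A → CountedB B
  interval-countedA⇒countedB A B si ii ca = record
    { spanIndep-B = si
    ; ι-B = begin
        ι M' B ≡⟨ ι≡#internallyActive M' B ⟩
        count (internallyActive M' B) ≡⟨ #internal-basis ⟩
        count (internallyActive M' A) + ∣ removed ∣ ≡⟨ cong₂ _+_ (trans (sym (ι≡#internallyActive M' A)) ι-A) (trans (sym corank-A) corank-A≡p) ⟩
        (i ∸ p) + p ≡⟨ m∸n+n≡m p≤i ⟩
        i ∎
    ; ε-B = begin
        ε M B ≡⟨ ε≡#externallyActive M B ⟩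
        count (externallyActive M B) ≡⟨ #external-basis ⟩
        count (externallyActive M A) + ∣ added ∣ ≡⟨ cong₂ _+_ (trans (sym (ε≡#externallyActive M A)) ε-A) (trans (sym nullity-A) nullity-A≡q) ⟩
        (j ∸ q) + q ≡⟨ m∸n+n≡m q≤j ⟩
        j ∎
    ; rcd-B = trans (sym (rcd-cong M M' A B rank-balance)) rcd-A
    }
    where
    open Interval A B si ii
    open CountedA ca
    open ≡-Reasoning

  countedB⇒interval-countedA : ∀ A B → CountedB B → InInterval B A → ∣ diff B A ∣ ≡ p → ∣ diff A B ∣ ≡ q → CountedA A
  countedB⇒interval-countedA A B cb ii #removed #added = record
    { ι-A = begin
        ι M' A ≡⟨ ι≡#internallyActive M' A ⟩
        count (internallyActive M' A) ≡⟨ sym (m+n∸n≡m _ p) ⟩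
        count (internallyActive M' A) + p ∸ p ≡⟨ cong (λ z → count (internallyActive M' A) + z ∸ p) (sym #removed) ⟩
        count (internallyActive M' A) + ∣ removed ∣ ∸ p ≡⟨ cong (_∸ p) (sym #internal-basis) ⟩
        count (internallyActive M' B) ∸ p ≡⟨ cong (_∸ p) (trans (sym (ι≡#internallyActive M' B)) ι-B) ⟩
        i ∸ p ∎
    ; ε-A = begin
        ε M A ≡⟨ ε≡#externallyActive M A ⟩
        count (externallyActive M A) ≡⟨ sym (m+n∸n≡m _ q) ⟩
        count (externallyActive M A) + q ∸ q ≡⟨ cong (λ z → count (externallyActive M A) + z ∸ q) (sym #added) ⟩
        count (externallyActive M A) + ∣ added ∣ ∸ q ≡⟨ cong (_∸ q) (sym #external-basis) ⟩
        count (externallyActive M B) ∸ q ≡⟨ cong (_∸ q) (trans (sym (ε≡#externallyActive M B)) ε-B) ⟩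
        j ∸ q ∎
    ; rcd-A = trans (rcd-cong M M' A B rank-balance) rcd-B
    ; corank-A≡p = trans corank-A #removed
    ; nullity-A≡q = trans nullity-A #added
    }
    where
    open CountedB cb
    open Interval A B spanIndep-B ii
    open ≡-Reasoning

  internalSet : Subset n → Subset n
  internalSet B = setOf (internallyActive M' B)

  externalSet : Subset n → Subset n
  externalSet B = setOf (externallyActive M B)

  InInterval⇒intervalAt : ∀ A B → InInterval B A → T (allF (intervalAt B (internalSet B) (externalSet B) A))
  InInterval⇒intervalAt A B inInterval = allF-mk (intervalAt B (internalSet B) (externalSet B) A) go
    where
    go : ∀ f → T (intervalAt B (internalSet B) (externalSet B) A f)
    go f with member? B f | member? A f
    ... | inj₁ b | inj₁ a = T∧ (T∨₁ (Tnot (λ z → Tnot⁻ (T∧₂ {lookup B f} z) a))) (T∨₁ (Tnot (λ z → Tnot⁻ (T∧₂ {lookup A f} z) b)))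
    ... | inj₁ b | inj₂ na = T∧ (T∨₂ {not (lookup B f ∧ not (lookup A f))} (setOf-intro (internallyActive M' B) (int-mk B f b (proj₁ inInterval f b na)))) (T∨₁ (Tnot (λ z → na (T∧₁ z))))
    ... | inj₂ nb | inj₁ a = T∧ (T∨₁ (Tnot (λ z → nb (T∧₁ z)))) (T∨₂ {not (lookup A f ∧ not (lookup B f))} (setOf-intro (externallyActive M B) (ext-mk B f nb (proj₂ inInterval f a nb))))
    ... | inj₂ nb | inj₂ na = T∧ (T∨₁ (Tnot (λ z → nb (T∧₁ z)))) (T∨₁ (Tnot (λ z → na (T∧₁ z))))

  intervalAt⇒InInterval : ∀ A B → T (allF (intervalAt B (internalSet B) (externalSet B) A)) → InInterval B A
  intervalAt⇒InInterval A B ok = h1 , h2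
    where
    h1 : ∀ f → T (lookup B f) → (T (lookup A f) → ⊥) → (Q.Cl f (belowOr B f) → ⊥)
    h1 f b na with T∨-elim {not (lookup B f ∧ not (lookup A f))} (T∧₁ (allF-T _ ok f))
    ... | inj₁ z = ⊥-elim (Tnot⁻ z (T∧ b (Tnot na)))
    ... | inj₂ z = proj₂ (int-in B f (setOf-elim (internallyActive M' B) z))
    h2 : ∀ f → T (lookup A f) → (T (lookup B f) → ⊥) → P.Cl f (above B f)
    h2 f a nb with T∨-elim {not (lookup A f ∧ not (lookup B f))} (T∧₂ {not (lookup B f ∧ not (lookup A f)) ∨ lookup (internalSet B) f} (allF-T _ ok f))
    ... | inj₁ z = ⊥-elim (Tnot⁻ z (T∧ a (Tnot nb)))
    ... | inj₂ z = proj₂ (ext-in B f (setOf-elim (externallyActive M B) z))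

  fibre⇒interval : ∀ B → CountedB B → ∀ A → T (countedA A ∧ sameSet (canonicalBasis A) B) →
    T (intervalWithSizes B (internalSet B) (externalSet B) p q A)
  fibre⇒interval B cb A t = T∧ (InInterval⇒intervalAt A B ii) (T∧ (≡⇒T≡ᵇ #removed) (≡⇒T≡ᵇ #added))
    where
    open CountedB cb
    ca : CountedA A
    ca = decodeA (proj₁ (split∧ {countedA A} t))
    ii : InInterval B A
    ii = subst (λ Z → InInterval Z A) (sameSet⇒≡ (canonicalBasis A) B (proj₂ (split∧ {countedA A} t))) (Canonical.inInterval A)
    #removed : ∣ diff B A ∣ ≡ p
    #removed = trans (sym (Interval.corank-A A B spanIndep-B ii)) (CountedA.corank-A≡p ca)
    #added : ∣ diff A B ∣ ≡ q
    #added = trans (sym (Interval.nullity-A A B spanIndep-B ii)) (CountedA.nullity-A≡q ca)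

  interval⇒fibre : ∀ B → CountedB B → ∀ A → T (intervalWithSizes B (internalSet B) (externalSet B) p q A) →
    T (countedA A ∧ sameSet (canonicalBasis A) B)
  interval⇒fibre B cb A t with split∧ {allF (intervalAt B (internalSet B) (externalSet B) A)} t
  ... | tI , tS with split∧ {∣ diff B A ∣ ≡ᵇ p} tS
  ... | tp , tq = T∧ (encodeA (countedB⇒interval-countedA A B cb ii (T≡ᵇ⇒≡ tp) (T≡ᵇ⇒≡ tq)))
                     (subst (λ Z → T (sameSet Z B)) (sym (Interval.canonicalBasis-interval A B (CountedB.spanIndep-B cb) ii)) (sameSet-refl B))
    where
    ii : InInterval B A
    ii = intervalAt⇒InInterval A B tI

  fibre-size : ∀ B → countB (λ A → countedA A ∧ sameSet (canonicalBasis A) B) (subsets n)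
                      ≡ (i C p) * (j C q) * indicator (countedB B)
  fibre-size B with Tdec (countedB B)
  ... | inj₂ ¬cb = trans (countB-false _ (subsets n) empty) (sym (trans (cong ((i C p) * (j C q) *_) (indicator-false ¬cb)) (*-zeroʳ ((i C p) * (j C q)))))
    where
    empty : ∀ A → T (countedA A ∧ sameSet (canonicalBasis A) B) → ⊥
    empty A t = ¬cb (subst (λ Z → T (countedB Z)) (sameSet⇒≡ (canonicalBasis A) B (proj₂ (split∧ {countedA A} t)))
                      (encodeB (interval-countedA⇒countedB A (canonicalBasis A) (Canonical.spanIndep A) (Canonical.inInterval A)
                                 (decodeA (proj₁ (split∧ {countedA A} t))))))
  ... | inj₁ tb = begin
      countB (λ A → countedA A ∧ sameSet (canonicalBasis A) B) (subsets n)
        ≡⟨ countB-cong (subsets n) (λ A → bext (fibre⇒interval B cb A) (interval⇒fibre B cb A)) ⟩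
      countB (intervalWithSizes B (internalSet B) (externalSet B) p q) (subsets n)
        ≡⟨ interval-count B (internalSet B) (externalSet B) internal⊑B external∉B p q ⟩
      (count (lookup (internalSet B)) C p) * (count (lookup (externalSet B)) C q)
        ≡⟨ cong₂ (λ x y → (x C p) * (y C q)) #internal #external ⟩
      (i C p) * (j C q)
        ≡⟨ sym (trans (cong ((i C p) * (j C q) *_) (indicator-true tb)) (*-identityʳ _)) ⟩
      (i C p) * (j C q) * indicator (countedB B) ∎
    where
    open ≡-Reasoning
    cb : CountedB B
    cb = decodeB tb
    open CountedB cb
    internal⊑B : ∀ f → T (lookup (internalSet B) f) → T (lookup B f)
    internal⊑B f z = T∧₁ (setOf-elim (internallyActive M' B) z)
    external∉B : ∀ f → T (lookup (externalSet B) f) → T (lookup B f) → ⊥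
    external∉B f z = Tnot⁻ (T∧₁ (setOf-elim (externallyActive M B) z))
    #internal : count (lookup (internalSet B)) ≡ i
    #internal = trans (count-cong (lookup-setOf (internallyActive M' B))) (trans (sym (ι≡#internallyActive M' B)) ι-B)
    #external : count (lookup (externalSet B)) ≡ j
    #external = trans (count-cong (lookup-setOf (externallyActive M B))) (trans (sym (ε≡#externallyActive M B)) ε-B)

lemma3 : ∀ {n} (M M' : Matroid n) → Perspective M M' →
    ∀ (i j k p q : ℕ) → p ≤ i → q ≤ j →
    a M M' (i ∸ p) (j ∸ q) k p q ≡ (i C p) * (j C q) * b M M' i j k
lemma3 {n} M M' pr i j k p q p≤i q≤j =
  fibre-counting countedA countedB canonicalBasis sameSet ((i C p) * (j C q)) (subsets n) (subsets n)
    (λ A → sameSet-unique (canonicalBasis A)) fibre-size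
  where
  open Counting M M' pr i j k p q p≤i q≤j
  open Decomposition M M' pr using (canonicalBasis)
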